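{- Let $m\ge1$ and let $S$ be a finite set of positive integers. Then every element of $\mathfrak P'_m(S)$ has pinnacle set $S$; the constructions defining $\mathfrak P'_m(S)$ never produce the same permutation twice (so $\mathfrak P'_m(S)$ is a disjoint union of the images and each construction is injective); and $\#\mathfrak P'_m(S)=p_m(S)/2^{m-1-|S|}$.
   Context: Permutations are written in one-line notation $\sigma=\sigma_1\cdots\sigma_m$ of $[m]=\{1,\dots,m\}$. $\mathrm{Pin}\,\sigma=\{\sigma_i\mid 1<i<m,\ \sigma_{i-1}<\sigma_i>\sigma_{i+1}\}$. A pinnacle set is a finite set $S$ of positive integers equal to $\mathrm{Pin}\,\sigma$ for some permutation $\sigma$ (equivalently $S=\{s_1<\dots<s_p\}$ with $s_i>2i$). $p_m(S)$ is the number of permutations of $[m]$ with pinnacle set $S$. For integers $a,b$, $[a,b]=\{a,\dots,b\}$ (empty if $a>b$). The sets $\mathfrak P'_m(S)\subseteq\mathfrak S_m$ (for $m\ge0$ and $S$ a finite set of positive integers) are defined recursively: if $S$ is not a pinnacle set or $m<\max S$, $\mathfrak P'_m(S)=\emptyset$; $\mathfrak P'_m(\emptyset)=\{12\cdots m\}$; if $S\neq\emptyset$ is a pinnacle set and $m>\max S$, $\mathfrak P'_m(S)$ consists of the words $\tau\,m$ for $\tau\in\mathfrak P'_{m-1}(S)$. If $S\ne\emptyset$ is a pinnacle set and $n=\max S$, let $t$ be the largest integer $<n$ not in $S$ and $T=\{s\in S\mid s<t\}$; then $\mathfrak P'_n(S)$ is the union of: (i) the permutations obtained from elements of $\mathfrak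 P'_n(T\cup\{t\}\cup[t+2,n])$ by exchanging the values $t$ and $t+1$; (ii) the permutations obtained from elements of $\mathfrak P'_{n-1}(T\cup[t,n-1])$ by replacing the letter $t$ by the two consecutive letters $t,t+1$, each letter $x>t$ by $x+1$, and keeping letters $x<t$; (iii) for each $q\in[t,n-2]$, the permutations obtained from elements of $\mathfrak P'_{n-2}(T\cup[t,n-2])$ by keeping letters $x<t$, replacing each letter $x\ge t$ with $x\neq q$ by $x+2$, and replacing the letter $q$ by the three consecutive letters $t+1,t,q+2$; (iv) the permutations obtained from elements of $\mathfrak P'_{n-2}(T\cup[t,n-2])$ by keeping letters $x<t$, replacing each letter $x\ge t$ by $x+2$, and appending the two letters $t+1,t$ at the end. -}

module Defs where

open import Data.Bool using (Bool; true; false; if_then_else_; _∧_; not)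
open import Data.Nat using (ℕ; zero; suc; _+_; _*_; _∸_; _⊔_; _<ᵇ_; _≡ᵇ_)
open import Data.List using (List; []; _∷_; _++_; map; concatMap; filterᵇ; foldr)
open import Data.Bool.ListAction using (any)
open import Data.Nat.ListAction using (sum)

range : ℕ → ℕ → List ℕ
range a b = go (suc b ∸ a) a
  where
  go : ℕ → ℕ → List ℕ
  go zero    _ = []
  go (suc k) x = x ∷ go k (suc x)

memb : ℕ → List ℕ → Bool
memb x = any (λ y → x ≡ᵇ y)

maxL : List ℕ → ℕ
maxL = foldr _⊔_ 0

pins : List ℕ → List ℕ
pins (a ∷ b ∷ c ∷ rest) =
  if (a <ᵇ b) ∧ (c <ᵇ b) then b ∷ pins (b ∷ c ∷ rest) else pins (b ∷ c ∷ rest)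
pins _ = []

-- For S = {s_1 < ... < s_p} given as a strictly increasing list:
-- S is a pinnacle set iff s_i > 2i for all i (characterisation from the context).
isPinFrom : ℕ → List ℕ → Bool
isPinFrom i []       = true
isPinFrom i (s ∷ ss) = ((2 * i) <ᵇ s) ∧ isPinFrom (suc i) ss

isPinSet : List ℕ → Bool
isPinSet = isPinFrom 1

-- largest integer ≤ k not in S (k is started at n-1, giving the t of the paper)
findT : ℕ → List ℕ → ℕ
findT zero    S = zero
findT (suc k) S = if memb (suc k) S then findT k S else suc k

swapTT1 : ℕ → ℕ → ℕ
swapTT1 t x = if x ≡ᵇ t then suc t else (if x ≡ᵇ suc t then t else x)

insII : ℕ → ℕ → List ℕ
insII t x = if x <ᵇ t then x ∷ [] else (if x ≡ᵇ t then t ∷ suc t ∷ [] else suc x ∷ [])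

insIII : ℕ → ℕ → ℕ → List ℕ
insIII t q x = if x <ᵇ t then x ∷ [] else (if x ≡ᵇ q then suc t ∷ t ∷ (q + 2) ∷ [] else (x + 2) ∷ [])

shIV : ℕ → ℕ → ℕ
shIV t x = if x <ᵇ t then x else x + 2

-- The recursive definition of 𝔓'_m(S), with sets S represented by strictly
-- increasing lists.  The recursion is well-founded for the measure m + ΣS
-- (every recursive call strictly decreases it), so it is run with a fuel
-- argument; P' below supplies fuel 1 + m + ΣS, which is always sufficient.
P'f : ℕ → ℕ → List ℕ → List (List ℕ)
P'f zero     m S        = []
P'f (suc f)  m []       = range 1 m ∷ []
P'f (suc f)  m (s ∷ ss) =
  if not (isPinSet S) then []
  else (if m <ᵇ n then []
  else (if n <ᵇ m then map (λ τ → τ ++ (m ∷ [])) (P'f f (m ∸ 1) S)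
  else main))
  where
  S : List ℕ
  S = s ∷ ss
  n : ℕ
  n = maxL S
  t : ℕ
  t = findT (n ∸ 1) S
  Tset : List ℕ
  Tset = filterᵇ (λ x → x <ᵇ t) S
  S1 S2 S3 : List ℕ
  S1 = Tset ++ (t ∷ range (t + 2) n)
  S2 = Tset ++ range t (n ∸ 1)
  S3 = Tset ++ range t (n ∸ 2)
  main : List (List ℕ)
  main =
       map (map (swapTT1 t)) (P'f f n S1)                                      -- (i)
    ++ map (concatMap (insII t)) (P'f f (n ∸ 1) S2)                            -- (ii)
    ++ concatMap (λ q → map (concatMap (insIII t q)) (P'f f (n ∸ 2) S3))
                 (range t (n ∸ 2))                                             -- (iii)
    ++ map (λ σ → map (shIV t) σ ++ (suc t ∷ t ∷ [])) (P'f f (n ∸ 2) S3)       -- (iv)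

P' : ℕ → List ℕ → List (List ℕ)
P' m S = P'f (suc (m + sum S)) m S

{-# OPTIONS --safe #-}
-- Write 𝔓_m(S) for the list of all permutations of [m] with pinnacle set S. It is generated by the
-- recursion defining 𝔓′_m(S) with every one-sided choice made two-sided: for m > max S the letter m
-- goes to either end, and for m = max S = n the words of (ii) together with the reverses of the words
-- of (iii) and (iv), which are exactly the words in which t is immediately followed by t+1, are taken
-- along with their reverses. Each construction acts on pinnacle sets by an order-preserving relabelling,
-- plus the new pinnacle t+1 in (iii) and (iv), so every generated word has pinnacle set S.
-- Conversely t+1 ∈ S is a pinnacle of any σ with pinnacle set S: if t is not next to t+1, swapping
-- them shows that σ comes from (i); if t precedes t+1, the letter before t (none, smaller than t,
-- larger than t+1) says whether σ comes from (iv), (ii) or (iii); if t follows t+1, the same applies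
-- to the reverse of σ. These features also separate the pieces, and every construction is injective.
-- Since 𝔓′ keeps one orientation at each doubling step, it is a sublist of 𝔓, and comparing lengths
-- along the recursion gives |𝔓_m(S)| = 2^(m-1-|S|) |𝔓′_m(S)|.
module Submission where

open import Defs
open import Data.Nat
open import Data.Nat.Properties
open import Data.Bool using (true; false; if_then_else_; _∧_; not)
open import Data.Bool.Properties using (T-≡)
open import Relation.Nullary.Decidable using (T?)
open import Data.List using (List; []; _∷_; _++_; map; concatMap; length; reverse; filterᵇ; InitLast; initLast; _∷ʳ′_)
open import Data.List.Properties hiding (sum-++)
open import Data.Nat.ListAction using (sum)
open import Data.Nat.ListAction.Properties using (sum-++)
open import Data.Nat.Solver using (module +-*-Solver)
open import Data.List.Membership.Propositional using (_∈_; _∉_; find; lose)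
open import Data.List.Membership.Propositional.Properties
  using (∈-++⁺ˡ; ∈-++⁺ʳ; ∈-++⁻; ∈-map⁺; ∈-map⁻; ∈-∃++; ∈-filter⁺; ∈-filter⁻; ∈-concatMap⁺; ∈-concatMap⁻)
open import Data.List.Relation.Unary.Any using (here; there)
import Data.List.Relation.Unary.Any as Any
import Data.List.Relation.Unary.Any.Properties as AnyP
open import Data.List.Relation.Unary.All using (All; []; _∷_)
import Data.List.Relation.Unary.All as All
open import Data.List.Relation.Binary.Pointwise using (Pointwise; []; _∷_)
import Data.List.Relation.Binary.Pointwise as Pointwise
open import Data.List.Relation.Unary.AllPairs using (AllPairs; []; _∷_)
import Data.List.Relation.Unary.AllPairs as AllPairs
import Data.List.Relation.Unary.AllPairs.Properties as AllPairs
open import Data.List.Relation.Unary.Linked using (Linked; []; [-]; _∷_)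
import Data.List.Relation.Unary.Linked as Linked
import Data.List.Relation.Unary.Linked.Properties as Linked
open import Data.List.Relation.Unary.Unique.Propositional using (Unique)
open import Data.List.Relation.Binary.Permutation.Propositional using (_↭_; ↭⇒↭ₛ)
import Data.List.Relation.Binary.Permutation.Propositional as ↭
import Data.List.Relation.Binary.Permutation.Propositional.Properties as ↭
import Data.List.Relation.Binary.Permutation.Setoid.Properties as ↭ₛ
open import Data.List.Relation.Binary.BagAndSetEquality using (∼bag⇒↭)
open import Data.List.Membership.Propositional.Properties.WithK using (unique∧set⇒bag)
import Data.List.Relation.Unary.Unique.Propositional.Properties as Unique
open import Data.List.Relation.Binary.Disjoint.Propositional using (Disjoint)
open import Data.List.Relation.Binary.Sublist.Propositional using (_⊆_; []; _∷_; _∷ʳ_; from∈; lookup)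
import Data.List.Relation.Binary.Sublist.Propositional.Properties as ⊆
open import Data.Product using (Σ; ∃; _×_; _,_; proj₁; proj₂; map₂)
open import Data.Sum using (_⊎_; inj₁; inj₂)
open import Data.Empty using (⊥; ⊥-elim)
open import Function using (_∘_)
open import Function.Bundles using (_⇔_; mk⇔; Equivalence)
open import Relation.Nullary using (¬_; yes; no; contradiction)
open import Relation.Binary.Definitions using (tri<; tri≈; tri>)
open import Relation.Binary.PropositionalEquality

open Equivalence using (to; from)

<ᵇ-true : ∀ {m n} → m < n → (m <ᵇ n) ≡ true
<ᵇ-true p = to T-≡ (<⇒<ᵇ p)

<ᵇ-true⁻ : ∀ {m n} → (m <ᵇ n) ≡ true → m < n
<ᵇ-true⁻ {m} {n} e = <ᵇ⇒< m n (from T-≡ e)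

<ᵇ-false : ∀ {m n} → n ≤ m → (m <ᵇ n) ≡ false
<ᵇ-false {m} {n} n≤m with m <ᵇ n in e
... | false = refl
... | true = ⊥-elim (<⇒≱ (<ᵇ-true⁻ e) n≤m)

<ᵇ-false⁻ : ∀ {m n} → (m <ᵇ n) ≡ false → n ≤ m
<ᵇ-false⁻ e = ≮⇒≥ λ m<n → contradiction (trans (sym (<ᵇ-true m<n)) e) λ ()

≡ᵇ-true : ∀ {m n} → m ≡ n → (m ≡ᵇ n) ≡ true
≡ᵇ-true {m} {n} p = to T-≡ (≡⇒≡ᵇ m n p)

≡ᵇ-true⁻ : ∀ {m n} → (m ≡ᵇ n) ≡ true → m ≡ n
≡ᵇ-true⁻ {m} {n} e = ≡ᵇ⇒≡ m n (from T-≡ e)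

≡ᵇ-false : ∀ {m n} → m ≢ n → (m ≡ᵇ n) ≡ false
≡ᵇ-false {m} {n} m≢n with m ≡ᵇ n in e
... | false = refl
... | true = ⊥-elim (m≢n (≡ᵇ-true⁻ e))

∧-true⁻ : ∀ {a b} → (a ∧ b) ≡ true → a ≡ true × b ≡ true
∧-true⁻ {true} e = refl , e

≤pred⇒< : ∀ {m n} → 1 ≤ n → m ≤ n ∸ 1 → m < n
≤pred⇒< 1≤n = m≤pred[n]⇒suc[m]≤n {{>-nonZero 1≤n}}

memb⁺ : ∀ {x S} → x ∈ S → memb x S ≡ true
memb⁺ {x} p = to T-≡ (AnyP.any⁺ _ (Any.map (λ {refl → from T-≡ (≡ᵇ-true {x} refl)}) p))

memb⁻ : ∀ {x S} → memb x S ≡ true → x ∈ S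
memb⁻ {x} {S} e = Any.map (≡ᵇ⇒≡ x _) (AnyP.any⁻ _ S (from T-≡ e))

≤-maxL : ∀ S {x} → x ∈ S → x ≤ maxL S
≤-maxL (y ∷ S) (here refl) = m≤m⊔n y (maxL S)
≤-maxL (y ∷ S) (there p) = ≤-trans (≤-maxL S p) (m≤n⊔m y (maxL S))

maxL-∈ : ∀ s ss → maxL (s ∷ ss) ∈ s ∷ ss
maxL-∈ s [] rewrite ⊔-identityʳ s = here refl
maxL-∈ s (s′ ∷ ss) with ⊔-sel s (maxL (s′ ∷ ss))
... | inj₁ e rewrite e = here refl
... | inj₂ e rewrite e = there (maxL-∈ s′ ss)

findT-≤ : ∀ k S → findT k S ≤ k
findT-≤ zero S = z≤n
findT-≤ (suc k) S with memb (suc k) S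
... | true = m≤n⇒m≤1+n (findT-≤ k S)
... | false = ≤-refl

findT-∉ : ∀ k S → findT k S ≡ 0 ⊎ findT k S ∉ S
findT-∉ zero S = inj₁ refl
findT-∉ (suc k) S with memb (suc k) S in e
... | true = findT-∉ k S
... | false = inj₂ λ p → contradiction (trans (sym (memb⁺ p)) e) λ ()

findT-<⇒∈ : ∀ k S x → findT k S < x → x ≤ k → x ∈ S
findT-<⇒∈ zero S x t<x x≤0 = ⊥-elim (<⇒≱ t<x (≤-trans x≤0 z≤n))
findT-<⇒∈ (suc k) S x t<x x≤k with memb (suc k) S in e
... | false = ⊥-elim (<⇒≱ t<x x≤k)
... | true with m≤n⇒m<n∨m≡n x≤k
...   | inj₁ x<1+k = findT-<⇒∈ k S x t<x (s≤s⁻¹ x<1+k)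
...   | inj₂ refl = memb⁻ e

∉⇒≤-findT : ∀ k S j → j ≤ k → j ∉ S → j ≤ findT k S
∉⇒≤-findT zero S j j≤k j∉S = j≤k
∉⇒≤-findT (suc k) S j j≤k j∉S with memb (suc k) S in e
... | false = j≤k
... | true with m≤n⇒m<n∨m≡n j≤k
...   | inj₁ j<1+k = ∉⇒≤-findT k S j (s≤s⁻¹ j<1+k) j∉S
...   | inj₂ refl = ⊥-elim (j∉S (memb⁻ e))

range-cons : ∀ a b → a ≤ b → range a b ≡ a ∷ range (suc a) b
range-cons a b a≤b rewrite +-∸-assoc 1 a≤b = refl

range-nil : ∀ a b → b < a → range a b ≡ []
range-nil a b b<a rewrite m≤n⇒m∸n≡0 b<a = refl

range-induction : (P : ℕ → ℕ → Set) →
  (∀ a b → b < a → P a b) → (∀ a b → a ≤ b → P (suc a) b → P a b) → ∀ a b → P a b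
range-induction P base step a b = go (suc b ∸ a) a refl
  where
  go : ∀ k a → suc b ∸ a ≡ k → P a b
  go zero a e = base a b (≮⇒≥ λ a≤b → 0≢1+n (trans (sym e) (+-∸-assoc 1 (s≤s⁻¹ a≤b))))
  go (suc k) a e with a ≤? b
  ... | no a≰b = base a b (≰⇒> a≰b)
  ... | yes a≤b = step a b a≤b (go k (suc a) (suc-injective (trans (sym (+-∸-assoc 1 a≤b)) e)))

∈-range⁻ : ∀ {x} a b → x ∈ range a b → a ≤ x × x ≤ b
∈-range⁻ {x} = range-induction (λ a b → x ∈ range a b → a ≤ x × x ≤ b)
  (λ a b b<a p → case (subst (x ∈_) (range-nil a b b<a) p))
  (λ a b a≤b ih p → step a b a≤b ih (subst (x ∈_) (range-cons a b a≤b) p))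
  where
  case : {A : Set} → x ∈ [] → A
  case ()
  step : ∀ a b → a ≤ b → (x ∈ range (suc a) b → suc a ≤ x × x ≤ b) →
         x ∈ a ∷ range (suc a) b → a ≤ x × x ≤ b
  step a b a≤b ih (here refl) = ≤-refl , a≤b
  step a b a≤b ih (there p) = let (a<x , x≤b) = ih p in <⇒≤ a<x , x≤b

∈-range⁺ : ∀ {x} a b → a ≤ x → x ≤ b → x ∈ range a b
∈-range⁺ {x} = range-induction (λ a b → a ≤ x → x ≤ b → x ∈ range a b)
  (λ a b b<a a≤x x≤b → ⊥-elim (<⇒≱ b<a (≤-trans a≤x x≤b)))
  (λ a b a≤b ih a≤x x≤b → subst (x ∈_) (sym (range-cons a b a≤b)) (step a a≤x (λ a<x → ih a<x x≤b)))
  where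
  step : ∀ {b} a → a ≤ x → (suc a ≤ x → x ∈ range (suc a) b) → x ∈ a ∷ range (suc a) b
  step a a≤x ih with m≤n⇒m<n∨m≡n a≤x
  ... | inj₁ a<x = there (ih a<x)
  ... | inj₂ refl = here refl

Sorted : List ℕ → Set
Sorted = AllPairs _<_

range-sorted : ∀ a b → Sorted (range a b)
range-sorted = range-induction (λ a b → Sorted (range a b))
  (λ a b b<a → subst Sorted (sym (range-nil a b b<a)) [])
  (λ a b a≤b ih → subst Sorted (sym (range-cons a b a≤b)) (All.tabulate (λ p → proj₁ (∈-range⁻ (suc a) b p)) ∷ ih))

sorted⇒unique : ∀ {xs} → Sorted xs → Unique xs
sorted⇒unique = AllPairs.map <⇒≢

range-snoc : ∀ a b → a ≤ suc b → range a (suc b) ≡ range a b ++ suc b ∷ []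
range-snoc = range-induction (λ a b → a ≤ suc b → range a (suc b) ≡ range a b ++ suc b ∷ [])
  (λ a b b<a a≤1+b → begin
     range a (suc b)          ≡⟨ range-cons a (suc b) a≤1+b ⟩
     a ∷ range (suc a) (suc b) ≡⟨ cong (a ∷_) (range-nil (suc a) (suc b) (s≤s b<a)) ⟩
     a ∷ []                   ≡⟨ cong (_∷ []) (≤-antisym a≤1+b b<a) ⟩
     suc b ∷ []               ≡⟨ cong (_++ suc b ∷ []) (sym (range-nil a b b<a)) ⟩
     range a b ++ suc b ∷ []  ∎)
  (λ a b a≤b ih _ → trans (range-cons a (suc b) (m≤n⇒m≤1+n a≤b))
      (trans (cong (a ∷_) (ih (s≤s a≤b))) (cong (_++ suc b ∷ []) (sym (range-cons a b a≤b)))))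
  where open ≡-Reasoning

map-suc-range : ∀ a b → map suc (range a b) ≡ range (suc a) (suc b)
map-suc-range = range-induction (λ a b → map suc (range a b) ≡ range (suc a) (suc b))
  (λ a b b<a → trans (cong (map suc) (range-nil a b b<a)) (sym (range-nil (suc a) (suc b) (s≤s b<a))))
  (λ a b a≤b ih → trans (cong (map suc) (range-cons a b a≤b))
      (trans (cong (suc a ∷_) ih) (sym (range-cons (suc a) (suc b) (s≤s a≤b)))))

Sorted-≡ : ∀ {xs ys} → Sorted xs → Sorted ys → (∀ x → x ∈ xs ⇔ x ∈ ys) → xs ≡ ys
Sorted-≡ {[]} {[]} _ _ _ = refl
Sorted-≡ {[]} {y ∷ ys} _ _ same with from (same y) (here refl)
... | ()
Sorted-≡ {x ∷ xs} {[]} _ _ same with to (same x) (here refl)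
... | ()
Sorted-≡ {x ∷ xs} {y ∷ ys} (x< ∷ sxs) (y< ∷ sys) same = cong₂ _∷_ x≡y (Sorted-≡ sxs sys same′)
  where
  x≡y : x ≡ y
  x≡y with to (same x) (here refl) | from (same y) (here refl)
  ... | here e | _ = e
  ... | _ | here e = sym e
  ... | there x∈ys | there y∈xs = ⊥-elim (<-asym (All.lookup y< x∈ys) (All.lookup x< y∈xs))
  same′ : ∀ z → z ∈ xs ⇔ z ∈ ys
  same′ z = mk⇔ into onto
    where
    into : z ∈ xs → z ∈ ys
    into p with to (same z) (there p)
    ... | here refl = ⊥-elim (<-irrefl x≡y (All.lookup x< p))
    ... | there q = q
    onto : z ∈ ys → z ∈ xs
    onto p with from (same z) (there p)
    ... | here refl = ⊥-elim (<-irrefl (sym x≡y) (All.lookup y< p))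
    ... | there q = q

sum-mono : ∀ {xs ys} → Pointwise _≤_ xs ys → sum xs ≤ sum ys
sum-mono [] = ≤-refl
sum-mono (x≤y ∷ xs≤ys) = +-mono-≤ x≤y (sum-mono xs≤ys)

≤-map-suc : ∀ xs → Pointwise _≤_ xs (map suc xs)
≤-map-suc [] = []
≤-map-suc (x ∷ xs) = n≤1+n x ∷ ≤-map-suc xs

isPinFrom⇒All : ∀ i S → isPinFrom i S ≡ true → All (λ s → 2 * i < s) S
isPinFrom⇒All i [] e = []
isPinFrom⇒All i (s ∷ ss) e = let (h , tl) = ∧-true⁻ e in
  <ᵇ-true⁻ h ∷ All.map (<-trans (*-monoʳ-< 2 (n<1+n i))) (isPinFrom⇒All (suc i) ss tl)

isPinSet⇒2< : ∀ S → isPinSet S ≡ true → ∀ {x} → x ∈ S → 2 < x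
isPinSet⇒2< S pin = All.lookup (isPinFrom⇒All 1 S pin)

isPinFrom⇒<maxL : ∀ i s ss → isPinFrom i (s ∷ ss) ≡ true → 2 * (i + length ss) < maxL (s ∷ ss)
isPinFrom⇒<maxL i s [] e =
  subst₂ _<_ (cong (2 *_) (sym (+-identityʳ i))) (sym (⊔-identityʳ s)) (<ᵇ-true⁻ (proj₁ (∧-true⁻ e)))
isPinFrom⇒<maxL i s (s′ ∷ ss) e = begin-strict
  2 * (i + length (s′ ∷ ss)) ≡⟨ cong (2 *_) (+-suc i (length ss)) ⟩
  2 * (suc i + length ss)    <⟨ isPinFrom⇒<maxL (suc i) s′ ss (proj₂ (∧-true⁻ {2 * i <ᵇ s} e)) ⟩
  maxL (s′ ∷ ss)             ≤⟨ m≤n⊔m s (maxL (s′ ∷ ss)) ⟩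
  maxL (s ∷ s′ ∷ ss)         ∎
  where open ≤-Reasoning

isPinFrom-++ : ∀ i xs ys → isPinFrom i (xs ++ ys) ≡ (isPinFrom i xs ∧ isPinFrom (i + length xs) ys)
isPinFrom-++ i [] ys rewrite +-identityʳ i = refl
isPinFrom-++ i (x ∷ xs) ys rewrite isPinFrom-++ (suc i) xs ys | +-suc i (length xs) with 2 * i <ᵇ x
... | true = refl
... | false = refl

isPinFrom-mono : ∀ i {xs ys} → Pointwise _≤_ xs ys → isPinFrom i xs ≡ true → isPinFrom i ys ≡ true
isPinFrom-mono i [] e = refl
isPinFrom-mono i (x≤y ∷ xs≤ys) e rewrite <ᵇ-true (<-≤-trans (<ᵇ-true⁻ (proj₁ (∧-true⁻ e))) x≤y) =
  isPinFrom-mono (suc i) xs≤ys (proj₂ (∧-true⁻ e))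

isPinSet-bound : ∀ xs {b} → isPinSet xs ≡ true → (∀ {x} → x ∈ xs → x < b) → 2 ≤ b → 2 * suc (length xs) ≤ b
isPinSet-bound [] _ _ 2≤b = 2≤b
isPinSet-bound (x ∷ xs) {b} pin xs<b _ = begin
  2 * suc (length (x ∷ xs))     ≡⟨ *-suc 2 (suc (length xs)) ⟩
  2 + 2 * suc (length xs)       ≤⟨ s≤s (isPinFrom⇒<maxL 1 x xs pin) ⟩
  suc (maxL (x ∷ xs))           ≤⟨ xs<b (maxL-∈ x xs) ⟩
  b                             ∎
  where open ≤-Reasoning

isPinFrom-map-+2 : ∀ i xs → isPinFrom (suc i) (map (λ x → suc (suc x)) xs) ≡ isPinFrom i xs
isPinFrom-map-+2 i [] = refl
isPinFrom-map-+2 i (x ∷ xs) rewrite isPinFrom-map-+2 (suc i) xs | +-suc i (i + 0) = refl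

Unique-resp-↭ : ∀ {xs ys : List ℕ} → xs ↭ ys → Unique xs → Unique ys
Unique-resp-↭ p = ↭ₛ.Unique-resp-↭ (setoid ℕ) (↭⇒↭ₛ p)

Unique-++⁻ʳ : ∀ (xs : List ℕ) {ys} → Unique (xs ++ ys) → Unique ys
Unique-++⁻ʳ [] u = u
Unique-++⁻ʳ (x ∷ xs) (_ ∷ u) = Unique-++⁻ʳ xs u

Unique-++⇒∉ : ∀ (xs : List ℕ) {ys x} → Unique (xs ++ ys) → x ∈ xs → x ∉ ys
Unique-++⇒∉ (y ∷ xs) (y∉ ∷ u) (here refl) q = All.lookup y∉ (∈-++⁺ʳ xs q) refl
Unique-++⇒∉ (y ∷ xs) (_ ∷ u) (there p) q = Unique-++⇒∉ xs u p q

Unique-mid : ∀ (l : List ℕ) x r → Unique (l ++ x ∷ r) → x ∉ l × x ∉ r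
Unique-mid l x r u = (λ p → Unique-++⇒∉ l u p (here refl)) , Unique.Unique[x∷xs]⇒x∉xs (Unique-++⁻ʳ l u)

Unique-split : ∀ (l l′ : List ℕ) x r r′ → Unique (l ++ x ∷ r) → l ++ x ∷ r ≡ l′ ++ x ∷ r′ → l ≡ l′ × r ≡ r′
Unique-split [] [] x r r′ u refl = refl , refl
Unique-split [] (y ∷ l′) x r r′ u e with ∷-injective e
... | refl , e′ = ⊥-elim (Unique.Unique[x∷xs]⇒x∉xs u (subst (x ∈_) (sym e′) (∈-++⁺ʳ l′ (here refl))))
Unique-split (y ∷ l) [] x r r′ u e with ∷-injective e
... | refl , _ = ⊥-elim (Unique.Unique[x∷xs]⇒x∉xs u (∈-++⁺ʳ l (here refl)))
Unique-split (y ∷ l) (y′ ∷ l′) x r r′ (_ ∷ u) e with ∷-injective e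
... | refl , e′ = let (l≡l′ , r≡r′) = Unique-split l l′ x r r′ u e′ in cong (y ∷_) l≡l′ , r≡r′

Unique-window : ∀ (l : List ℕ) a x c r → Unique (l ++ a ∷ x ∷ c ∷ r) → x ∉ l × x ∉ c ∷ r
Unique-window l a x c r u =
  let (x∉la , x∉cr) = Unique-mid (l ++ a ∷ []) x (c ∷ r) (subst Unique (sym (++-assoc l (a ∷ []) (x ∷ c ∷ r))) u)
  in (λ p → x∉la (∈-++⁺ˡ p)) , x∉cr

Unique-block : ∀ (l W r : List ℕ) → Unique (l ++ W ++ r) → ∀ {x y} → y ∈ W → x ∈ l ⊎ x ∈ r → x ≢ y
Unique-block l W r u y∈W (inj₁ x∈l) refl = Unique-++⇒∉ l u x∈l (∈-++⁺ˡ y∈W)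
Unique-block l W r u y∈W (inj₂ x∈r) refl =
  Unique-++⇒∉ (l ++ W) (subst Unique (sym (++-assoc l W r)) u) (∈-++⁺ʳ l y∈W) x∈r

Unique-concatMap : ∀ {A B : Set} (blk : A → List B) (qs : List A) → Unique qs →
  (∀ {q} → q ∈ qs → Unique (blk q)) →
  (∀ {q q′ σ} → q ∈ qs → q′ ∈ qs → σ ∈ blk q → σ ∈ blk q′ → q ≡ q′) →
  Unique (concatMap blk qs)
Unique-concatMap blk [] _ _ _ = []
Unique-concatMap blk (q ∷ qs) (q∉qs ∷ uqs) ublk sep =
  Unique.++⁺ (ublk (here refl)) (Unique-concatMap blk qs uqs (ublk ∘ there) (λ p p′ → sep (there p) (there p′)))
    λ (σ∈q , σ∈qs) → let (q′ , q′∈ , σ∈q′) = find (∈-concatMap⁻ blk {xs = qs} σ∈qs) in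
                     All.lookup q∉qs q′∈ (sep (here refl) (there q′∈) σ∈q σ∈q′)

Unique-⊆ : ∀ {xs ys : List (List ℕ)} → xs ⊆ ys → Unique ys → Unique xs
Unique-⊆ [] [] = []
Unique-⊆ (y ∷ʳ xs⊆ys) (_ ∷ u) = Unique-⊆ xs⊆ys u
Unique-⊆ (refl ∷ xs⊆ys) (x∉ ∷ u) = ⊆.All-resp-⊆ xs⊆ys x∉ ∷ Unique-⊆ xs⊆ys u

concatMap-⊆ : ∀ {A B : Set} (f g : A → List B) xs → (∀ x → f x ⊆ g x) → concatMap f xs ⊆ concatMap g xs
concatMap-⊆ f g [] _ = []
concatMap-⊆ f g (x ∷ xs) f⊆g = ⊆.++⁺ (f⊆g x) (concatMap-⊆ f g xs f⊆g)

InRange : ℕ → ℕ → Set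
InRange n x = 1 ≤ x × x ≤ n

Perm : ℕ → List ℕ → Set
Perm m σ = σ ↭ range 1 m

Perm-intro : ∀ m σ → Unique σ → (∀ x → x ∈ σ ⇔ InRange m x) → Perm m σ
Perm-intro m σ u σ≈[1,m] = ∼bag⇒↭ (unique∧set⇒bag u (sorted⇒unique (range-sorted 1 m))
  (mk⇔ (λ p → let (a , b) = to (σ≈[1,m] _) p in ∈-range⁺ 1 m a b)
       (λ p → from (σ≈[1,m] _) (∈-range⁻ 1 m p))))

Perm⇒Unique : ∀ {m σ} → Perm m σ → Unique σ
Perm⇒Unique p = Unique-resp-↭ (↭.↭-sym p) (sorted⇒unique (range-sorted 1 _))

Perm-∈⁻ : ∀ {m σ x} → Perm m σ → x ∈ σ → InRange m x
Perm-∈⁻ p q = ∈-range⁻ 1 _ (↭.∈-resp-↭ p q)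

Perm-∈⁺ : ∀ {m σ x} → Perm m σ → InRange m x → x ∈ σ
Perm-∈⁺ p (a , b) = ↭.∈-resp-↭ (↭.↭-sym p) (∈-range⁺ 1 _ a b)

Perm-resp-↭ : ∀ {n σ σ′} → σ ↭ σ′ → Perm n σ → Perm n σ′
Perm-resp-↭ e p = ↭.↭-trans (↭.↭-sym e) p

Perm-∷-max : ∀ k {τ} → Perm k τ ⇔ Perm (suc k) (suc k ∷ τ)
Perm-∷-max k {τ} = mk⇔
  (λ p → ↭.↭-trans (↭.↭-prep (suc k) p) (↭.↭-trans (↭.∷↭∷ʳ (suc k) (range 1 k)) (↭.↭-reflexive (sym top))))
  (λ p → ↭.drop-∷ (↭.↭-trans p (↭.↭-trans (↭.↭-reflexive top) (↭.↭-sym (↭.∷↭∷ʳ (suc k) (range 1 k))))))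
  where
  top : range 1 (suc k) ≡ range 1 k ++ suc k ∷ []
  top = range-snoc 1 k (s≤s z≤n)

Splits : ℕ → ℕ → List ℕ → (ℕ → ℕ) → Set
Splits n k ext g = ∀ x → InRange n x ⇔ (x ∈ ext ⊎ ∃ λ y → g y ≡ x × InRange k y)

module _ {n k ext g} (g-inj : ∀ {a b} → g a ≡ g b → a ≡ b)
         (g∉ext : ∀ y → InRange k y → g y ∉ ext) (split : Splits n k ext g) where

  Perm-++-map : ∀ {τ} → Unique ext → Perm k τ → Perm n (ext ++ map g τ)
  Perm-++-map {τ} uext pτ = Perm-intro n _ (Unique.++⁺ uext (Unique.map⁺ g-inj (Perm⇒Unique pτ)) disj)
    λ x → mk⇔ (into x) (onto x)
    where
    disj : Disjoint ext (map g τ)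
    disj (p , q) with ∈-map⁻ g q
    ... | y , y∈τ , refl = g∉ext y (Perm-∈⁻ pτ y∈τ) p
    into : ∀ x → x ∈ ext ++ map g τ → InRange n x
    into x p with ∈-++⁻ ext p
    ... | inj₁ q = from (split x) (inj₁ q)
    ... | inj₂ q with ∈-map⁻ g q
    ...   | y , y∈τ , refl = from (split x) (inj₂ (y , refl , Perm-∈⁻ pτ y∈τ))
    onto : ∀ x → InRange n x → x ∈ ext ++ map g τ
    onto x x∈ with to (split x) x∈
    ... | inj₁ q = ∈-++⁺ˡ q
    ... | inj₂ (y , refl , y∈) = ∈-++⁺ʳ ext (∈-map⁺ g (Perm-∈⁺ pτ y∈))

  Perm-++-map⁻ : ∀ {τ} → Perm n (ext ++ map g τ) → Perm k τ
  Perm-++-map⁻ {τ} pσ = Perm-intro k τ (Unique.map⁻ (Unique-++⁻ʳ ext (Perm⇒Unique pσ))) λ y → mk⇔ (into y) (onto y)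
    where
    into : ∀ y → y ∈ τ → InRange k y
    into y p with to (split (g y)) (Perm-∈⁻ pσ (∈-++⁺ʳ ext (∈-map⁺ g p)))
    ... | inj₁ q = ⊥-elim (Unique-++⇒∉ ext (Perm⇒Unique pσ) q (∈-map⁺ g p))
    ... | inj₂ (y′ , e , y′∈) = subst (InRange k) (g-inj e) y′∈
    onto : ∀ y → InRange k y → y ∈ τ
    onto y y∈ with ∈-++⁻ ext (Perm-∈⁺ pσ (from (split (g y)) (inj₂ (y , refl , y∈))))
    ... | inj₁ q = ⊥-elim (g∉ext y y∈ q)
    ... | inj₂ q with ∈-map⁻ g q
    ...   | y′ , y′∈τ , e = subst (_∈ τ) (sym (g-inj e)) y′∈τ

shift-past : ∀ (xs : List ℕ) a v ys → xs ++ a ∷ v ∷ ys ↭ v ∷ xs ++ a ∷ ys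
shift-past xs a v ys = begin
    xs ++ a ∷ v ∷ ys          ≡⟨ ++-assoc xs (a ∷ []) (v ∷ ys) ⟨
    (xs ++ a ∷ []) ++ v ∷ ys  ↭⟨ ↭.shift v (xs ++ a ∷ []) ys ⟩
    v ∷ (xs ++ a ∷ []) ++ ys  ≡⟨ cong (v ∷_) (++-assoc xs (a ∷ []) ys) ⟩
    v ∷ xs ++ a ∷ ys          ∎
  where open ↭.PermutationReasoning

shift₂-past : ∀ (xs : List ℕ) a u v ys → xs ++ a ∷ u ∷ v ∷ ys ↭ u ∷ v ∷ xs ++ a ∷ ys
shift₂-past xs a u v ys = ↭.↭-trans (shift-past xs a u (v ∷ ys)) (↭.↭-prep u (shift-past xs a v ys))

reverse-sandwich : ∀ (l W r : List ℕ) → reverse (l ++ W ++ r) ≡ reverse r ++ reverse W ++ reverse l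
reverse-sandwich l W r = begin
    reverse (l ++ W ++ r)                  ≡⟨ reverse-++ l (W ++ r) ⟩
    reverse (W ++ r) ++ reverse l          ≡⟨ cong (_++ reverse l) (reverse-++ W r) ⟩
    (reverse r ++ reverse W) ++ reverse l  ≡⟨ ++-assoc (reverse r) (reverse W) (reverse l) ⟩
    reverse r ++ reverse W ++ reverse l    ∎
  where open ≡-Reasoning

map-reverse-reverse : ∀ (h : List ℕ → List ℕ) xs → map reverse (map (reverse ∘ h) xs) ≡ map h xs
map-reverse-reverse h xs = trans (sym (map-∘ xs)) (map-cong (reverse-involutive ∘ h) xs)

Adjacent : List ℕ → ℕ → ℕ → Set
Adjacent σ x y = Σ (List ℕ) λ l → Σ (List ℕ) λ r → σ ≡ l ++ x ∷ y ∷ r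

Adjacent-∷ : ∀ y {σ a b} → Adjacent σ a b → Adjacent (y ∷ σ) a b
Adjacent-∷ y (l , r , refl) = y ∷ l , r , refl

Adjacent-reverse : ∀ σ {x y} → Adjacent σ x y → Adjacent (reverse σ) y x
Adjacent-reverse σ {x} {y} (l , r , refl) = reverse r , reverse l , (begin
    reverse (l ++ x ∷ y ∷ r)                ≡⟨ reverse-++ l (x ∷ y ∷ r) ⟩
    reverse ((x ∷ y ∷ []) ++ r) ++ reverse l ≡⟨ cong (_++ reverse l) (reverse-++ (x ∷ y ∷ []) r) ⟩
    (reverse r ++ y ∷ x ∷ []) ++ reverse l   ≡⟨ ++-assoc (reverse r) (y ∷ x ∷ []) (reverse l) ⟩
    reverse r ++ y ∷ x ∷ reverse l ∎)
  where open ≡-Reasoning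

Adjacent-both-ways : ∀ σ {x y} → Unique σ → Adjacent σ x y → Adjacent σ y x → x ≢ y → ⊥
Adjacent-both-ways σ {x} {y} u (l , r , refl) (l′ , r′ , e) x≢y =
  let (l≡ , _) = Unique-split l (l′ ++ y ∷ []) x (y ∷ r) r′ u (trans e (sym (++-assoc l′ (y ∷ []) (x ∷ r′))))
      u′ : Unique ((l′ ++ y ∷ []) ++ x ∷ y ∷ r)
      u′ = subst (λ z → Unique (z ++ x ∷ y ∷ r)) l≡ u
  in Unique-++⇒∉ (l′ ++ y ∷ []) u′ (∈-++⁺ʳ l′ (here refl)) (there (here refl))

Adjacent-pred-unique : ∀ σ {a a′ x} → Unique σ → Adjacent σ a x → Adjacent σ a′ x → a ≡ a′
Adjacent-pred-unique σ {a} {a′} {x} u (l , r , refl) (l′ , r′ , e) =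
  let (l≡ , _) = Unique-split (l ++ a ∷ []) (l′ ++ a′ ∷ []) x r r′
                   (subst Unique (sym (++-assoc l (a ∷ []) (x ∷ r))) u)
                   (trans (++-assoc l (a ∷ []) (x ∷ r)) (trans e (sym (++-assoc l′ (a′ ∷ []) (x ∷ r′)))))
  in proj₂ (∷ʳ-injective l l′ l≡)

Adjacent-succ-unique : ∀ σ {x c c′} → Unique σ → Adjacent σ x c → Adjacent σ x c′ → c ≡ c′
Adjacent-succ-unique σ {x} u (l , r , refl) (l′ , r′ , e) =
  proj₁ (∷-injective (proj₂ (Unique-split l l′ x (_ ∷ r) (_ ∷ r′) u e)))

Adjacent-not-first : ∀ σ {a x} r → Unique σ → Adjacent σ a x → σ ≢ x ∷ r
Adjacent-not-first σ {a} {x} r₀ u (l , r , refl) e =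
  let (l≡ , _) = Unique-split (l ++ a ∷ []) [] x r r₀
                   (subst Unique (sym (++-assoc l (a ∷ []) (x ∷ r))) u)
                   (trans (++-assoc l (a ∷ []) (x ∷ r)) e)
  in ∷ʳ-≢[] l a l≡
  where
  ∷ʳ-≢[] : ∀ (l : List ℕ) a → l ++ a ∷ [] ≢ []
  ∷ʳ-≢[] [] a ()
  ∷ʳ-≢[] (_ ∷ _) a ()

Adjacent⇒Linked : ∀ {R : ℕ → ℕ → Set} σ → (∀ {a b} → Adjacent σ a b → R a b) → Linked R σ
Adjacent⇒Linked [] _ = []
Adjacent⇒Linked (a ∷ []) _ = [-]
Adjacent⇒Linked (a ∷ b ∷ σ) adj = adj ([] , σ , refl) ∷ Adjacent⇒Linked (b ∷ σ) (adj ∘ Adjacent-∷ a)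

Linked⇒Adjacent : ∀ {R : ℕ → ℕ → Set} {σ a b} → Linked R σ → Adjacent σ a b → R a b
Linked⇒Adjacent {σ = σ} lnk ([] , r , refl) = Linked.head lnk
Linked⇒Adjacent lnk (x ∷ l , r , refl) = Linked⇒Adjacent (Linked.tail lnk) (l , r , refl)

Linked-all : ∀ {R : ℕ → ℕ → Set} → (∀ a b → R a b) → ∀ xs → Linked R xs
Linked-all r [] = []
Linked-all r (a ∷ []) = [-]
Linked-all r (a ∷ b ∷ xs) = r a b ∷ Linked-all r (b ∷ xs)

KeepsOrder : (ℕ → ℕ) → ℕ → ℕ → Set
KeepsOrder f a b = (a <ᵇ b) ≡ (f a <ᵇ f b) × (b <ᵇ a) ≡ (f b <ᵇ f a)

pins-map : ∀ f xs → Linked (KeepsOrder f) xs → pins (map f xs) ≡ map f (pins xs)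
pins-map f [] _ = refl
pins-map f (a ∷ []) _ = refl
pins-map f (a ∷ b ∷ []) _ = refl
pins-map f (a ∷ b ∷ c ∷ r) ((ab , _) ∷ ks@((_ , cb) ∷ _)) = step (pins-map f (b ∷ c ∷ r) ks)
  where
  step : pins (map f (b ∷ c ∷ r)) ≡ map f (pins (b ∷ c ∷ r)) →
         pins (map f (a ∷ b ∷ c ∷ r)) ≡ map f (pins (a ∷ b ∷ c ∷ r))
  step ih rewrite sym ab | sym cb with (a <ᵇ b) ∧ (c <ᵇ b)
  ... | true = cong (f b ∷_) ih
  ... | false = ih

<ᵇ-preserved-pair : ∀ (f : ℕ → ℕ) {a b} → (a < b → f a < f b) → (b < a → f b < f a) →
                    (a <ᵇ b) ≡ (f a <ᵇ f b)
<ᵇ-preserved-pair f {a} {b} mono mono′ with <-cmp a b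
... | tri< a<b _ _ = trans (<ᵇ-true a<b) (sym (<ᵇ-true (mono a<b)))
... | tri≈ _ refl _ = trans (<ᵇ-false {a} ≤-refl) (sym (<ᵇ-false {f a} ≤-refl))
... | tri> _ _ b<a = trans (<ᵇ-false (<⇒≤ b<a)) (sym (<ᵇ-false (<⇒≤ (mono′ b<a))))

<ᵇ-preserved : ∀ (f : ℕ → ℕ) → (∀ {a b} → a < b → f a < f b) → ∀ a b → (a <ᵇ b) ≡ (f a <ᵇ f b)
<ᵇ-preserved f mono a b = <ᵇ-preserved-pair f mono mono

pins-map-monotone : ∀ f → (∀ a b → (a <ᵇ b) ≡ (f a <ᵇ f b)) → ∀ xs → pins (map f xs) ≡ map f (pins xs)
pins-map-monotone f mono xs = pins-map f xs (Linked-all (λ a b → mono a b , mono b a) xs)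

pins-++ : ∀ l a b r → pins (l ++ a ∷ b ∷ r) ≡ pins (l ++ a ∷ b ∷ []) ++ pins (a ∷ b ∷ r)
pins-++ [] a b r = refl
pins-++ (x ∷ []) a b r with (x <ᵇ a) ∧ (b <ᵇ a)
... | true = refl
... | false = refl
pins-++ (x ∷ y ∷ []) a b r with (x <ᵇ y) ∧ (a <ᵇ y)
... | true = cong (y ∷_) (pins-++ (y ∷ []) a b r)
... | false = pins-++ (y ∷ []) a b r
pins-++ (x ∷ y ∷ z ∷ l) a b r = step (pins-++ (y ∷ z ∷ l) a b r)
  where
  step : pins (y ∷ z ∷ l ++ a ∷ b ∷ r) ≡ pins (y ∷ z ∷ l ++ a ∷ b ∷ []) ++ pins (a ∷ b ∷ r) →
         pins (x ∷ y ∷ z ∷ l ++ a ∷ b ∷ r) ≡ pins (x ∷ y ∷ z ∷ l ++ a ∷ b ∷ []) ++ pins (a ∷ b ∷ r)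
  step ih with (x <ᵇ y) ∧ (z <ᵇ y)
  ... | true = cong (y ∷_) ih
  ... | false = ih

pins-last-cong : ∀ l a b b′ → (b <ᵇ a) ≡ (b′ <ᵇ a) → pins (l ++ a ∷ b ∷ []) ≡ pins (l ++ a ∷ b′ ∷ [])
pins-last-cong [] a b b′ e = refl
pins-last-cong (x ∷ []) a b b′ e rewrite e = refl
pins-last-cong (x ∷ y ∷ []) a b b′ e with (x <ᵇ y) ∧ (a <ᵇ y)
... | true = cong (y ∷_) (pins-last-cong (y ∷ []) a b b′ e)
... | false = pins-last-cong (y ∷ []) a b b′ e
pins-last-cong (x ∷ y ∷ z ∷ l) a b b′ e = step (pins-last-cong (y ∷ z ∷ l) a b b′ e)
  where
  step : pins (y ∷ z ∷ l ++ a ∷ b ∷ []) ≡ pins (y ∷ z ∷ l ++ a ∷ b′ ∷ []) →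
         pins (x ∷ y ∷ z ∷ l ++ a ∷ b ∷ []) ≡ pins (x ∷ y ∷ z ∷ l ++ a ∷ b′ ∷ [])
  step ih with (x <ᵇ y) ∧ (z <ᵇ y)
  ... | true = cong (y ∷_) ih
  ... | false = ih

pins-drop-last-ascent : ∀ l a b → (b <ᵇ a) ≡ false → pins (l ++ a ∷ b ∷ []) ≡ pins (l ++ a ∷ [])
pins-drop-last-ascent [] a b e = refl
pins-drop-last-ascent (x ∷ []) a b e rewrite e with x <ᵇ a
... | true = refl
... | false = refl
pins-drop-last-ascent (x ∷ y ∷ []) a b e with (x <ᵇ y) ∧ (a <ᵇ y)
... | true = cong (y ∷_) (pins-drop-last-ascent (y ∷ []) a b e)
... | false = pins-drop-last-ascent (y ∷ []) a b e
pins-drop-last-ascent (x ∷ y ∷ z ∷ l) a b e = step (pins-drop-last-ascent (y ∷ z ∷ l) a b e)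
  where
  step : pins (y ∷ z ∷ l ++ a ∷ b ∷ []) ≡ pins (y ∷ z ∷ l ++ a ∷ []) →
         pins (x ∷ y ∷ z ∷ l ++ a ∷ b ∷ []) ≡ pins (x ∷ y ∷ z ∷ l ++ a ∷ [])
  step ih with (x <ᵇ y) ∧ (z <ᵇ y)
  ... | true = cong (y ∷_) ih
  ... | false = ih

pins-head-cong : ∀ u a v r → (u <ᵇ v) ≡ (a <ᵇ v) → pins (u ∷ v ∷ r) ≡ pins (a ∷ v ∷ r)
pins-head-cong u a v [] e = refl
pins-head-cong u a v (c ∷ r) e rewrite e = refl

pins-∷-max : ∀ m τ → All (_< m) τ → pins (m ∷ τ) ≡ pins τ
pins-∷-max m [] _ = refl
pins-∷-max m (a ∷ []) _ = refl
pins-∷-max m (a ∷ b ∷ τ) (a<m ∷ _) rewrite <ᵇ-false {m} {a} (<⇒≤ a<m) = refl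

pins-∷ʳ-max : ∀ m τ → All (_< m) τ → pins (τ ++ m ∷ []) ≡ pins τ
pins-∷ʳ-max m [] _ = refl
pins-∷ʳ-max m (a ∷ []) _ = refl
pins-∷ʳ-max m (a ∷ b ∷ []) (_ ∷ b<m ∷ []) rewrite <ᵇ-false {m} {b} (<⇒≤ b<m) with a <ᵇ b
... | true = refl
... | false = refl
pins-∷ʳ-max m (a ∷ b ∷ c ∷ r) (_ ∷ ps) = step (pins-∷ʳ-max m (b ∷ c ∷ r) ps)
  where
  step : pins (b ∷ c ∷ r ++ m ∷ []) ≡ pins (b ∷ c ∷ r) → pins (a ∷ b ∷ c ∷ r ++ m ∷ []) ≡ pins (a ∷ b ∷ c ∷ r)
  step ih with (a <ᵇ b) ∧ (c <ᵇ b)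
  ... | true = cong (b ∷_) ih
  ... | false = ih

Peak : List ℕ → ℕ → Set
Peak σ x = Σ (List ℕ) λ l → Σ ℕ λ a → Σ ℕ λ c → Σ (List ℕ) λ r → σ ≡ l ++ a ∷ x ∷ c ∷ r × a < x × c < x

Peak-∷ : ∀ y {σ x} → Peak σ x → Peak (y ∷ σ) x
Peak-∷ y (l , a , c , r , refl , a<x , c<x) = y ∷ l , a , c , r , refl , a<x , c<x

pins⇒Peak : ∀ σ {x} → x ∈ pins σ → Peak σ x
pins⇒Peak (a ∷ b ∷ c ∷ r) {x} = step (pins⇒Peak (b ∷ c ∷ r))
  where
  step : (∀ {y} → y ∈ pins (b ∷ c ∷ r) → Peak (b ∷ c ∷ r) y) → x ∈ pins (a ∷ b ∷ c ∷ r) → Peak (a ∷ b ∷ c ∷ r) x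
  step ih p with a <ᵇ b in ab | c <ᵇ b in cb
  step ih (here refl) | true | true = [] , a , c , r , refl , <ᵇ-true⁻ ab , <ᵇ-true⁻ cb
  step ih (there p)   | true | true = Peak-∷ a (ih p)
  step ih p | true | false = Peak-∷ a (ih p)
  step ih p | false | _ = Peak-∷ a (ih p)

pins-∷⁺ : ∀ y xs {x} → x ∈ pins xs → x ∈ pins (y ∷ xs)
pins-∷⁺ y (a ∷ b ∷ c ∷ r) p with (y <ᵇ a) ∧ (b <ᵇ a)
... | true = there p
... | false = p

Peak⇒pins : ∀ l a x c r → a < x → c < x → x ∈ pins (l ++ a ∷ x ∷ c ∷ r)
Peak⇒pins [] a x c r a<x c<x rewrite <ᵇ-true a<x | <ᵇ-true c<x = here refl
Peak⇒pins (y ∷ l) a x c r a<x c<x = pins-∷⁺ y (l ++ a ∷ x ∷ c ∷ r) (Peak⇒pins l a x c r a<x c<x)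

pins⊆ : ∀ σ {x} → x ∈ pins σ → x ∈ σ
pins⊆ σ p with pins⇒Peak σ p
... | l , _ , _ , _ , refl , _ = ∈-++⁺ʳ l (there (here refl))

pins⇒Adjacent< : ∀ {σ x y} → Unique σ → x ∈ pins σ → Adjacent σ x y ⊎ Adjacent σ y x → y < x
pins⇒Adjacent< {σ} {x} u p adj with pins⇒Peak σ p
... | l , a , c , r , refl , a<x , c<x with adj
...   | inj₁ x,y = subst (_< x) (Adjacent-succ-unique σ u (l ++ a ∷ [] , r , sym (++-assoc l (a ∷ []) _)) x,y) c<x
...   | inj₂ y,x = subst (_< x) (Adjacent-pred-unique σ u (l , c ∷ r , refl) y,x) a<x

last∉pins : ∀ {τ} (l : List ℕ) z → Unique τ → τ ≡ l ++ z ∷ [] → z ∉ pins τ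
last∉pins {τ} l z u e p with pins⇒Peak τ p
... | l′ , a′ , c′ , r′ , e′ , _ =
  case (proj₂ (Unique-split l (l′ ++ a′ ∷ []) z [] (c′ ∷ r′) (subst Unique e u)
                 (trans (sym e) (trans e′ (sym (++-assoc l′ (a′ ∷ []) (z ∷ c′ ∷ r′)))))))
  where
  case : [] ≢ c′ ∷ r′
  case ()

Sorted⇒∉pins : ∀ {σ x} → Sorted σ → x ∉ pins σ
Sorted⇒∉pins {σ} σ↗ p with pins⇒Peak σ p
... | l , a , c , r , refl , _ , c<x with drop-prefix l σ↗
  where
  drop-prefix : ∀ (l : List ℕ) {ys} → Sorted (l ++ ys) → Sorted ys
  drop-prefix [] s = s
  drop-prefix (_ ∷ l) (_ ∷ s) = drop-prefix l s
...   | _ ∷ (x<c ∷ _) ∷ _ = <-asym c<x x<c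

pins-reverse⁺ : ∀ σ {x} → x ∈ pins σ → x ∈ pins (reverse σ)
pins-reverse⁺ σ {x} p with pins⇒Peak σ p
... | l , a , c , r , refl , a<x , c<x =
  subst (λ z → x ∈ pins z) (sym (reverse-sandwich l (a ∷ x ∷ c ∷ []) r)) (Peak⇒pins (reverse r) c x a (reverse l) c<x a<x)

pins-reverse⁻ : ∀ σ {x} → x ∈ pins (reverse σ) → x ∈ pins σ
pins-reverse⁻ σ {x} p = subst (λ z → x ∈ pins z) (reverse-involutive σ) (pins-reverse⁺ (reverse σ) p)

pins-skip-ascent : ∀ l a u v r → a < u → u < v → pins (l ++ a ∷ u ∷ v ∷ r) ≡ pins (l ++ a ∷ v ∷ r)
pins-skip-ascent l a u v r a<u u<v = begin
    pins (l ++ a ∷ u ∷ v ∷ r)                  ≡⟨ pins-++ l a u (v ∷ r) ⟩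
    pins (l ++ a ∷ u ∷ []) ++ pins (a ∷ u ∷ v ∷ r)
      ≡⟨ cong₂ _++_ (pins-last-cong l a u v (trans (<ᵇ-false (<⇒≤ a<u)) (sym (<ᵇ-false (<⇒≤ a<v))))) middle ⟩
    pins (l ++ a ∷ v ∷ []) ++ pins (a ∷ v ∷ r) ≡⟨ sym (pins-++ l a v r) ⟩
    pins (l ++ a ∷ v ∷ r) ∎
  where
  open ≡-Reasoning
  a<v = <-trans a<u u<v
  middle : pins (a ∷ u ∷ v ∷ r) ≡ pins (a ∷ v ∷ r)
  middle rewrite <ᵇ-true a<u | <ᵇ-false {v} {u} (<⇒≤ u<v) =
    pins-head-cong u a v r (trans (<ᵇ-true u<v) (sym (<ᵇ-true a<v)))

pins-insert-peak : ∀ l a u w v r → a < u → w < u → w < v → a < v →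
  pins (l ++ a ∷ u ∷ w ∷ v ∷ r) ≡ pins (l ++ a ∷ v ∷ []) ++ u ∷ pins (a ∷ v ∷ r)
pins-insert-peak l a u w v r a<u w<u w<v a<v = begin
    pins (l ++ a ∷ u ∷ w ∷ v ∷ r)                      ≡⟨ pins-++ l a u (w ∷ v ∷ r) ⟩
    pins (l ++ a ∷ u ∷ []) ++ pins (a ∷ u ∷ w ∷ v ∷ r)
      ≡⟨ cong₂ _++_ (pins-last-cong l a u v (trans (<ᵇ-false (<⇒≤ a<u)) (sym (<ᵇ-false (<⇒≤ a<v))))) middle ⟩
    pins (l ++ a ∷ v ∷ []) ++ u ∷ pins (a ∷ v ∷ r) ∎
  where
  open ≡-Reasoning
  middle : pins (a ∷ u ∷ w ∷ v ∷ r) ≡ u ∷ pins (a ∷ v ∷ r)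
  middle rewrite <ᵇ-true a<u | <ᵇ-true w<u | <ᵇ-false {u} {w} (<⇒≤ w<u) =
    cong (u ∷_) (pins-head-cong w a v r (trans (<ᵇ-true w<v) (sym (<ᵇ-true a<v))))

pins-append-peak : ∀ l z u w → z < u → w < u → pins (l ++ z ∷ u ∷ w ∷ []) ≡ pins (l ++ z ∷ []) ++ u ∷ []
pins-append-peak l z u w z<u w<u = begin
    pins (l ++ z ∷ u ∷ w ∷ [])                    ≡⟨ pins-++ l z u (w ∷ []) ⟩
    pins (l ++ z ∷ u ∷ []) ++ pins (z ∷ u ∷ w ∷ []) ≡⟨ cong₂ _++_ (pins-drop-last-ascent l z u (<ᵇ-false (<⇒≤ z<u))) tail-peak ⟩
    pins (l ++ z ∷ []) ++ u ∷ [] ∎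
  where
  open ≡-Reasoning
  tail-peak : pins (z ∷ u ∷ w ∷ []) ≡ u ∷ []
  tail-peak rewrite <ᵇ-true z<u | <ᵇ-true w<u = refl

HasPins : List ℕ → List ℕ → Set
HasPins σ S = ∀ x → x ∈ pins σ ⇔ x ∈ S

module _ {g : ℕ → ℕ} {ext S S′ : List ℕ} (key : ∀ y → g y ∈ S ⇔ y ∈ S′) where

  HasPins-transfer : ∀ σ τ → pins σ ↭ ext ++ map g (pins τ) →
    (∀ {x} → x ∈ ext → x ∈ S) → (∀ {x} → x ∈ S → x ∈ ext ⊎ ∃ λ y → g y ≡ x) →
    HasPins τ S′ → HasPins σ S
  HasPins-transfer σ τ pσ ext⊆S S⊆ext∪g hτ x = mk⇔ into onto
    where
    into : x ∈ pins σ → x ∈ S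
    into p with ∈-++⁻ ext (↭.∈-resp-↭ pσ p)
    ... | inj₁ x∈ext = ext⊆S x∈ext
    ... | inj₂ q with ∈-map⁻ g q
    ...   | y , y∈ , refl = from (key y) (to (hτ y) y∈)
    onto : x ∈ S → x ∈ pins σ
    onto x∈S = ↭.∈-resp-↭ (↭.↭-sym pσ) (case (S⊆ext∪g x∈S))
      where
      case : x ∈ ext ⊎ ∃ (λ y → g y ≡ x) → x ∈ ext ++ map g (pins τ)
      case (inj₁ x∈ext) = ∈-++⁺ˡ x∈ext
      case (inj₂ (y , refl)) = ∈-++⁺ʳ ext (∈-map⁺ g (from (hτ y) (to (key y) x∈S)))

  HasPins-transfer⁻ : ∀ σ τ → pins σ ↭ ext ++ map g (pins τ) →
    (∀ y → g y ∉ ext) → (∀ {a b} → g a ≡ g b → a ≡ b) → HasPins σ S → HasPins τ S′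
  HasPins-transfer⁻ σ τ pσ g∉ext g-inj hσ y = mk⇔ into onto
    where
    into : y ∈ pins τ → y ∈ S′
    into p = to (key y) (to (hσ (g y)) (↭.∈-resp-↭ (↭.↭-sym pσ) (∈-++⁺ʳ ext (∈-map⁺ g p))))
    onto : y ∈ S′ → y ∈ pins τ
    onto p with ∈-++⁻ ext (↭.∈-resp-↭ pσ (from (hσ (g y)) (from (key y) p)))
    ... | inj₁ gy∈ext = ⊥-elim (g∉ext y gy∈ext)
    ... | inj₂ q with ∈-map⁻ g q
    ...   | y′ , y′∈ , e = subst (_∈ pins τ) (sym (g-inj e)) y′∈

-- lift k t opens a gap [t, t+k) in ℕ; shIV t is lift 2 t definitionally.
lift : ℕ → ℕ → ℕ → ℕ
lift k t y = if y <ᵇ t then y else y + k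

unlift : ℕ → ℕ → ℕ → ℕ
unlift k t x = if x <ᵇ t then x else x ∸ k

InGap : ℕ → ℕ → ℕ → Set
InGap k t x = t ≤ x × x < t + k

module _ {k t : ℕ} where

  lift-< : ∀ {y} → y < t → lift k t y ≡ y
  lift-< y<t rewrite <ᵇ-true y<t = refl

  lift-≥ : ∀ {y} → t ≤ y → lift k t y ≡ y + k
  lift-≥ t≤y rewrite <ᵇ-false t≤y = refl

  unlift-< : ∀ {x} → x < t → unlift k t x ≡ x
  unlift-< x<t rewrite <ᵇ-true x<t = refl

  unlift-≥ : ∀ {x} → t ≤ x → unlift k t x ≡ x ∸ k
  unlift-≥ t≤x rewrite <ᵇ-false t≤x = refl

  lift-∉gap : ∀ y → ¬ InGap k t (lift k t y)
  lift-∉gap y (t≤x , x<t+k) with y <? t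
  ... | yes y<t = <⇒≱ y<t (subst (t ≤_) (lift-< y<t) t≤x)
  ... | no y≮t = <⇒≱ (subst (_< t + k) (lift-≥ (≮⇒≥ y≮t)) x<t+k) (+-monoˡ-≤ k (≮⇒≥ y≮t))

  unlift-lift : ∀ y → unlift k t (lift k t y) ≡ y
  unlift-lift y with y <? t
  ... | yes y<t rewrite lift-< y<t = unlift-< y<t
  ... | no y≮t rewrite lift-≥ (≮⇒≥ y≮t) =
    trans (unlift-≥ (≤-trans (≮⇒≥ y≮t) (m≤m+n y k))) (m+n∸n≡m y k)

  lift-unlift : ∀ x → ¬ InGap k t x → lift k t (unlift k t x) ≡ x
  lift-unlift x x∉gap with x <? t
  ... | yes x<t rewrite unlift-< x<t = lift-< x<t
  ... | no x≮t rewrite unlift-≥ (≮⇒≥ x≮t) = trans (lift-≥ t≤x-k) (m∸n+n≡m k≤x)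
    where
    t+k≤x : t + k ≤ x
    t+k≤x = ≮⇒≥ λ x<t+k → x∉gap (≮⇒≥ x≮t , x<t+k)
    k≤x : k ≤ x
    k≤x = ≤-trans (m≤n+m k t) t+k≤x
    t≤x-k : t ≤ x ∸ k
    t≤x-k = m+n≤o⇒m≤o∸n t t+k≤x

  lift-injective : ∀ {a b} → lift k t a ≡ lift k t b → a ≡ b
  lift-injective {a} {b} e = trans (sym (unlift-lift a)) (trans (cong (unlift k t) e) (unlift-lift b))

  map-lift-unlift : ∀ xs → (∀ {x} → x ∈ xs → ¬ InGap k t x) → map (lift k t) (map (unlift k t) xs) ≡ xs
  map-lift-unlift xs out = trans (sym (map-∘ xs)) (trans (map-cong-local (All.tabulate λ x∈ → lift-unlift _ (out x∈))) (map-id xs))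

  ∉-map-unlift : ∀ {y} xs → (∀ {x} → x ∈ xs → ¬ InGap k t x) → lift k t y ∉ xs → y ∉ map (unlift k t) xs
  ∉-map-unlift xs out ly∉xs p with ∈-map⁻ (unlift k t) p
  ... | x , x∈ , refl = ly∉xs (subst (_∈ xs) (sym (lift-unlift x (out x∈))) x∈)

  lift-strictMono : ∀ {a b} → a < b → lift k t a < lift k t b
  lift-strictMono {a} {b} a<b with a <? t
  ... | yes a<t rewrite lift-< a<t = <-≤-trans a<b (lift-≥-self b)
    where
    lift-≥-self : ∀ y → y ≤ lift k t y
    lift-≥-self y with y <? t
    ... | yes y<t = ≤-reflexive (sym (lift-< y<t))
    ... | no y≮t = ≤-trans (m≤m+n y k) (≤-reflexive (sym (lift-≥ (≮⇒≥ y≮t))))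
  ... | no a≮t rewrite lift-≥ (≮⇒≥ a≮t) | lift-≥ {b} (≤-trans (≮⇒≥ a≮t) (<⇒≤ a<b)) = +-monoˡ-< k a<b

  lift-<ᵇ : ∀ a b → (a <ᵇ b) ≡ (lift k t a <ᵇ lift k t b)
  lift-<ᵇ = <ᵇ-preserved (lift k t) lift-strictMono

  lift-splits : ∀ {n ext} → 1 ≤ t → t + k ≤ suc n → (∀ x → x ∈ ext ⇔ InGap k t x) →
                Splits n (n ∸ k) ext (lift k t)
  lift-splits {n} {ext} 1≤t t+k≤1+n ext≈gap x = mk⇔ into onto
    where
    k≤n : k ≤ n
    k≤n = s≤s⁻¹ (≤-trans (+-monoˡ-≤ k 1≤t) t+k≤1+n)
    into : InRange n x → x ∈ ext ⊎ ∃ λ y → lift k t y ≡ x × InRange (n ∸ k) y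
    into (1≤x , x≤n) with x <? t | t + k ≤? x
    ... | yes x<t | _ = inj₂ (x , lift-< x<t , 1≤x , m+n≤o⇒m≤o∸n x (s≤s⁻¹ (≤-trans (+-mono-≤ x<t ≤-refl) t+k≤1+n)))
    ... | no x≮t | yes t+k≤x =
      inj₂ (unlift k t x , lift-unlift x (λ (_ , x<t+k) → <⇒≱ x<t+k t+k≤x) ,
            subst (InRange (n ∸ k)) (sym (unlift-≥ (≮⇒≥ x≮t)))
              (≤-trans 1≤t (m+n≤o⇒m≤o∸n t t+k≤x) , ∸-monoˡ-≤ k x≤n))
    ... | no x≮t | no t+k≰x = inj₁ (from (ext≈gap x) (≮⇒≥ x≮t , ≰⇒> t+k≰x))
    onto : x ∈ ext ⊎ ∃ (λ y → lift k t y ≡ x × InRange (n ∸ k) y) → InRange n x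
    onto (inj₁ x∈ext) = let (t≤x , x<t+k) = to (ext≈gap x) x∈ext in
      ≤-trans 1≤t t≤x , s≤s⁻¹ (≤-trans x<t+k t+k≤1+n)
    onto (inj₂ (y , refl , 1≤y , y≤n-k)) with y <? t
    ... | yes y<t rewrite lift-< y<t = 1≤y , ≤-trans y≤n-k (m∸n≤m n k)
    ... | no y≮t rewrite lift-≥ (≮⇒≥ y≮t) =
      ≤-trans 1≤y (m≤m+n y k) , subst (y + k ≤_) (m∸n+n≡m k≤n) (+-monoˡ-≤ k y≤n-k)

module _ {t : ℕ} where

  swapTT1-t : swapTT1 t t ≡ suc t
  swapTT1-t rewrite ≡ᵇ-true {t} refl = refl

  swapTT1-suc : swapTT1 t (suc t) ≡ t
  swapTT1-suc rewrite ≡ᵇ-false {suc t} {t} (λ e → <-irrefl (sym e) (n<1+n t)) | ≡ᵇ-true {suc t} refl = refl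

  swapTT1-other : ∀ {y} → y ≢ t → y ≢ suc t → swapTT1 t y ≡ y
  swapTT1-other y≢t y≢1+t rewrite ≡ᵇ-false y≢t | ≡ᵇ-false y≢1+t = refl

  data TT1View (y : ℕ) : Set where
    isT : y ≡ t → TT1View y
    isSucT : y ≡ suc t → TT1View y
    isOther : y ≢ t → y ≢ suc t → TT1View y

  tt1View : ∀ y → TT1View y
  tt1View y with y ≟ t | y ≟ suc t
  ... | yes e | _ = isT e
  ... | no _ | yes e = isSucT e
  ... | no y≢t | no y≢1+t = isOther y≢t y≢1+t

  swapTT1-involutive : ∀ y → swapTT1 t (swapTT1 t y) ≡ y
  swapTT1-involutive y with tt1View y
  ... | isT refl rewrite swapTT1-t = swapTT1-suc
  ... | isSucT refl rewrite swapTT1-suc = swapTT1-t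
  ... | isOther y≢t y≢1+t rewrite swapTT1-other y≢t y≢1+t = swapTT1-other y≢t y≢1+t

  swapTT1-injective : ∀ {a b} → swapTT1 t a ≡ swapTT1 t b → a ≡ b
  swapTT1-injective {a} {b} e =
    trans (sym (swapTT1-involutive a)) (trans (cong (swapTT1 t) e) (swapTT1-involutive b))

  NotTT1 : ℕ → ℕ → Set
  NotTT1 a b = ¬ (a ≡ t × b ≡ suc t) × ¬ (a ≡ suc t × b ≡ t)

  swapTT1-strictMono : ∀ {a b} → NotTT1 a b → a < b → swapTT1 t a < swapTT1 t b
  swapTT1-strictMono {a} {b} (¬t,1+t , _) a<b with tt1View a | tt1View b
  ... | isT refl | isT refl = ⊥-elim (<-irrefl refl a<b)
  ... | isT refl | isSucT refl = ⊥-elim (¬t,1+t (refl , refl))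
  ... | isT refl | isOther b≢t b≢1+t rewrite swapTT1-t | swapTT1-other b≢t b≢1+t = ≤∧≢⇒< a<b (b≢1+t ∘ sym)
  ... | isSucT refl | isOther b≢t b≢1+t rewrite swapTT1-suc | swapTT1-other b≢t b≢1+t = <-trans (n<1+n t) a<b
  ... | isSucT refl | isT refl = ⊥-elim (<-asym a<b (n<1+n t))
  ... | isSucT refl | isSucT refl = ⊥-elim (<-irrefl refl a<b)
  ... | isOther a≢t a≢1+t | isT refl rewrite swapTT1-other a≢t a≢1+t | swapTT1-t = <-trans a<b (n<1+n t)
  ... | isOther a≢t a≢1+t | isSucT refl rewrite swapTT1-other a≢t a≢1+t | swapTT1-suc = ≤∧≢⇒< (s≤s⁻¹ a<b) a≢t
  ... | isOther a≢t a≢1+t | isOther b≢t b≢1+t rewrite swapTT1-other a≢t a≢1+t | swapTT1-other b≢t b≢1+t = a<b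

  NotTT1-sym : ∀ {a b} → NotTT1 a b → NotTT1 b a
  NotTT1-sym (p , q) = (λ (b≡ , a≡) → q (a≡ , b≡)) , (λ (b≡ , a≡) → p (a≡ , b≡))

  swapTT1-keepsOrder : ∀ {a b} → NotTT1 a b → KeepsOrder (swapTT1 t) a b
  swapTT1-keepsOrder ab = <ᵇ-preserved-pair (swapTT1 t) (swapTT1-strictMono ab) (swapTT1-strictMono (NotTT1-sym ab))
                        , <ᵇ-preserved-pair (swapTT1 t) (swapTT1-strictMono (NotTT1-sym ab)) (swapTT1-strictMono ab)

  NotTT1-swapTT1 : ∀ {a b} → NotTT1 a b → NotTT1 (swapTT1 t a) (swapTT1 t b)
  NotTT1-swapTT1 (p , q) =
    (λ (a≡ , b≡) → q (swapTT1-injective (trans a≡ (sym swapTT1-suc)) , swapTT1-injective (trans b≡ (sym swapTT1-t)))) ,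
    (λ (a≡ , b≡) → p (swapTT1-injective (trans a≡ (sym swapTT1-t)) , swapTT1-injective (trans b≡ (sym swapTT1-suc))))

  swapTT1-splits : ∀ {n} → 1 ≤ t → t < n → Splits n n [] (swapTT1 t)
  swapTT1-splits {n} 1≤t t<n x = mk⇔
    (λ x∈ → inj₂ (swapTT1 t x , swapTT1-involutive x , inRange x∈))
    (λ { (inj₂ (y , refl , y∈)) → inRange y∈ })
    where
    inRange : ∀ {y} → InRange n y → InRange n (swapTT1 t y)
    inRange {y} y∈ with tt1View y
    ... | isT refl rewrite swapTT1-t = s≤s z≤n , t<n
    ... | isSucT refl rewrite swapTT1-suc = 1≤t , <⇒≤ t<n
    ... | isOther y≢t y≢1+t rewrite swapTT1-other y≢t y≢1+t = y∈

consI consII : ℕ → List ℕ → List ℕ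
consI t = map (swapTT1 t)
consII t = concatMap (insII t)

consIII : ℕ → ℕ → List ℕ → List ℕ
consIII t q = concatMap (insIII t q)

consIV : ℕ → List ℕ → List ℕ
consIV t τ = map (shIV t) τ ++ suc t ∷ t ∷ []

consI-involutive : ∀ t σ → consI t (consI t σ) ≡ σ
consI-involutive t σ = trans (sym (map-∘ σ)) (trans (map-cong swapTT1-involutive σ) (map-id σ))

consI-injective : ∀ t {a b} → consI t a ≡ consI t b → a ≡ b
consI-injective t = map-injective swapTT1-injective

concatMap-singleton : ∀ (h : ℕ → List ℕ) g xs → (∀ {x} → x ∈ xs → h x ≡ g x ∷ []) → concatMap h xs ≡ map g xs
concatMap-singleton h g [] _ = refl
concatMap-singleton h g (x ∷ xs) hx rewrite hx (here refl) = cong (g x ∷_) (concatMap-singleton h g xs (hx ∘ there))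

insII-≢ : ∀ t {x} → x ≢ t → insII t x ≡ lift 1 t x ∷ []
insII-≢ t {x} x≢t with x <ᵇ t
... | true = refl
... | false rewrite ≡ᵇ-false x≢t = cong (_∷ []) (+-comm 1 x)

insIII-≢ : ∀ t q {x} → x ≢ q → insIII t q x ≡ shIV t x ∷ []
insIII-≢ t q {x} x≢q with x <ᵇ t
... | true = refl
... | false rewrite ≡ᵇ-false x≢q = refl

lift-t : ∀ t → lift 1 t t ≡ suc t
lift-t t = trans (lift-≥ {1} {t} ≤-refl) (+-comm t 1)

lift-≢ : ∀ k t y → 1 ≤ k → lift k t y ≢ t
lift-≢ k t y 1≤k e = lift-∉gap {k} {t} y (≤-reflexive (sym e) , subst (_< t + k) (sym e) (m<m+n t 1≤k))

lift-≢suc : ∀ k t y → 2 ≤ k → lift k t y ≢ suc t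
lift-≢suc k t y 2≤k e =
  lift-∉gap {k} {t} y (subst (t ≤_) (sym e) (n≤1+n t) , subst (_< t + k) (sym e) (subst (_≤ t + k) (+-comm t 2) (+-monoʳ-≤ t 2≤k)))

consII-split : ∀ t l r → t ∉ l → t ∉ r →
  consII t (l ++ t ∷ r) ≡ map (lift 1 t) l ++ t ∷ suc t ∷ map (lift 1 t) r
consII-split t l r t∉l t∉r = begin
    concatMap (insII t) (l ++ t ∷ r)
      ≡⟨ concatMap-++ (insII t) l (t ∷ r) ⟩
    concatMap (insII t) l ++ insII t t ++ concatMap (insII t) r
      ≡⟨ cong₂ (λ u v → u ++ v ++ concatMap (insII t) r) (single l t∉l) insII-t ⟩
    map (lift 1 t) l ++ t ∷ suc t ∷ concatMap (insII t) r
      ≡⟨ cong (λ z → map (lift 1 t) l ++ t ∷ suc t ∷ z) (single r t∉r) ⟩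
    map (lift 1 t) l ++ t ∷ suc t ∷ map (lift 1 t) r ∎
  where
  open ≡-Reasoning
  single : ∀ xs → t ∉ xs → concatMap (insII t) xs ≡ map (lift 1 t) xs
  single xs t∉xs = concatMap-singleton (insII t) (lift 1 t) xs λ x∈ → insII-≢ t λ {refl → t∉xs x∈}
  insII-t : insII t t ≡ t ∷ suc t ∷ []
  insII-t rewrite <ᵇ-false {t} {t} ≤-refl | ≡ᵇ-true {t} refl = refl

consIII-split : ∀ t q l r → t ≤ q → q ∉ l → q ∉ r →
  consIII t q (l ++ q ∷ r) ≡ map (shIV t) l ++ suc t ∷ t ∷ q + 2 ∷ map (shIV t) r
consIII-split t q l r t≤q q∉l q∉r = begin
    concatMap (insIII t q) (l ++ q ∷ r)
      ≡⟨ concatMap-++ (insIII t q) l (q ∷ r) ⟩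
    concatMap (insIII t q) l ++ insIII t q q ++ concatMap (insIII t q) r
      ≡⟨ cong₂ (λ u v → u ++ v ++ concatMap (insIII t q) r) (single l q∉l) insIII-q ⟩
    map (shIV t) l ++ suc t ∷ t ∷ q + 2 ∷ concatMap (insIII t q) r
      ≡⟨ cong (λ z → map (shIV t) l ++ suc t ∷ t ∷ q + 2 ∷ z) (single r q∉r) ⟩
    map (shIV t) l ++ suc t ∷ t ∷ q + 2 ∷ map (shIV t) r ∎
  where
  open ≡-Reasoning
  single : ∀ xs → q ∉ xs → concatMap (insIII t q) xs ≡ map (shIV t) xs
  single xs q∉xs = concatMap-singleton (insIII t q) (shIV t) xs λ x∈ → insIII-≢ t q λ {refl → q∉xs x∈}
  insIII-q : insIII t q q ≡ suc t ∷ t ∷ q + 2 ∷ []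
  insIII-q rewrite <ᵇ-false {q} {t} t≤q | ≡ᵇ-true {q} refl = refl

map-lift-at : ∀ k t l b x r → b < t → map (lift k t) (l ++ b ∷ x ∷ r) ≡ map (lift k t) l ++ b ∷ lift k t x ∷ map (lift k t) r
map-lift-at k t l b x r b<t = trans (map-++ (lift k t) l (b ∷ x ∷ r))
  (cong (λ z → map (lift k t) l ++ z ∷ lift k t x ∷ map (lift k t) r) (lift-< b<t))

consII-at : ∀ t l b r → b < t → t ∉ l → t ∉ r →
  consII t (l ++ b ∷ t ∷ r) ≡ map (lift 1 t) l ++ b ∷ t ∷ suc t ∷ map (lift 1 t) r
consII-at t l b r b<t t∉l t∉r = begin
    consII t (l ++ b ∷ t ∷ r)                      ≡⟨ cong (consII t) (sym (++-assoc l (b ∷ []) (t ∷ r))) ⟩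
    consII t ((l ++ b ∷ []) ++ t ∷ r)              ≡⟨ consII-split t (l ++ b ∷ []) r t∉lb t∉r ⟩
    map (lift 1 t) (l ++ b ∷ []) ++ t ∷ suc t ∷ R  ≡⟨ cong (_++ t ∷ suc t ∷ R) (map-++ (lift 1 t) l (b ∷ [])) ⟩
    (L ++ lift 1 t b ∷ []) ++ t ∷ suc t ∷ R        ≡⟨ ++-assoc L _ _ ⟩
    L ++ lift 1 t b ∷ t ∷ suc t ∷ R                ≡⟨ cong (λ z → L ++ z ∷ t ∷ suc t ∷ R) (lift-< b<t) ⟩
    L ++ b ∷ t ∷ suc t ∷ R                         ∎
  where
  open ≡-Reasoning
  L = map (lift 1 t) l
  R = map (lift 1 t) r
  t∉lb : t ∉ l ++ b ∷ []
  t∉lb p with ∈-++⁻ l p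
  ... | inj₁ t∈l = t∉l t∈l
  ... | inj₂ (here t≡b) = <-irrefl (sym t≡b) b<t

consIII-at : ∀ t q l a r → a < t → t ≤ q → q ∉ l → q ∉ r →
  consIII t q (l ++ a ∷ q ∷ r) ≡ map (shIV t) l ++ a ∷ suc t ∷ t ∷ q + 2 ∷ map (shIV t) r
consIII-at t q l a r a<t t≤q q∉l q∉r = begin
    consIII t q (l ++ a ∷ q ∷ r)                          ≡⟨ cong (consIII t q) (sym (++-assoc l (a ∷ []) (q ∷ r))) ⟩
    consIII t q ((l ++ a ∷ []) ++ q ∷ r)                  ≡⟨ consIII-split t q (l ++ a ∷ []) r t≤q q∉la q∉r ⟩
    map (shIV t) (l ++ a ∷ []) ++ suc t ∷ t ∷ q + 2 ∷ R    ≡⟨ cong (_++ suc t ∷ t ∷ q + 2 ∷ R) (map-++ (shIV t) l (a ∷ [])) ⟩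
    (L ++ shIV t a ∷ []) ++ suc t ∷ t ∷ q + 2 ∷ R          ≡⟨ ++-assoc L _ _ ⟩
    L ++ shIV t a ∷ suc t ∷ t ∷ q + 2 ∷ R                  ≡⟨ cong (λ z → L ++ z ∷ suc t ∷ t ∷ q + 2 ∷ R) (lift-< a<t) ⟩
    L ++ a ∷ suc t ∷ t ∷ q + 2 ∷ R ∎
  where
  open ≡-Reasoning
  L = map (shIV t) l
  R = map (shIV t) r
  q∉la : q ∉ l ++ a ∷ []
  q∉la p with ∈-++⁻ l p
  ... | inj₁ q∈l = q∉l q∈l
  ... | inj₂ (here refl) = <⇒≱ a<t t≤q

consIV-at : ∀ t l z → z < t → consIV t (l ++ z ∷ []) ≡ map (shIV t) l ++ z ∷ suc t ∷ t ∷ []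
consIV-at t l z z<t = begin
    map (shIV t) (l ++ z ∷ []) ++ suc t ∷ t ∷ []             ≡⟨ cong (_++ suc t ∷ t ∷ []) (map-++ (shIV t) l (z ∷ [])) ⟩
    (map (shIV t) l ++ shIV t z ∷ []) ++ suc t ∷ t ∷ []       ≡⟨ ++-assoc (map (shIV t) l) (shIV t z ∷ []) _ ⟩
    map (shIV t) l ++ shIV t z ∷ suc t ∷ t ∷ []               ≡⟨ cong (λ u → map (shIV t) l ++ u ∷ suc t ∷ t ∷ []) (lift-< z<t) ⟩
    map (shIV t) l ++ z ∷ suc t ∷ t ∷ [] ∎
  where open ≡-Reasoning

consII-at-↭ : ∀ t l b r → b < t → t ∉ l → t ∉ r → consII t (l ++ b ∷ t ∷ r) ↭ t ∷ map (lift 1 t) (l ++ b ∷ t ∷ r)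
consII-at-↭ t l b r b<t t∉l t∉r = begin
    consII t (l ++ b ∷ t ∷ r)        ≡⟨ consII-at t l b r b<t t∉l t∉r ⟩
    L ++ b ∷ t ∷ suc t ∷ R           ↭⟨ shift-past L b t (suc t ∷ R) ⟩
    t ∷ L ++ b ∷ suc t ∷ R           ≡⟨ cong (t ∷_) (trans (map-lift-at 1 t l b t r b<t) (cong (λ z → L ++ b ∷ z ∷ R) (lift-t t))) ⟨
    t ∷ map (lift 1 t) (l ++ b ∷ t ∷ r) ∎
  where
  open ↭.PermutationReasoning
  L = map (lift 1 t) l
  R = map (lift 1 t) r

consIII-at-↭ : ∀ t q l a r → a < t → t ≤ q → q ∉ l → q ∉ r →
  consIII t q (l ++ a ∷ q ∷ r) ↭ suc t ∷ t ∷ map (shIV t) (l ++ a ∷ q ∷ r)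
consIII-at-↭ t q l a r a<t t≤q q∉l q∉r = begin
    consIII t q (l ++ a ∷ q ∷ r)          ≡⟨ consIII-at t q l a r a<t t≤q q∉l q∉r ⟩
    L ++ a ∷ suc t ∷ t ∷ q + 2 ∷ R         ↭⟨ shift₂-past L a (suc t) t (q + 2 ∷ R) ⟩
    suc t ∷ t ∷ L ++ a ∷ q + 2 ∷ R         ≡⟨ cong (λ z → suc t ∷ t ∷ z) (trans (map-lift-at 2 t l a q r a<t) (cong (λ z → L ++ a ∷ z ∷ R) (lift-≥ t≤q))) ⟨
    suc t ∷ t ∷ map (shIV t) (l ++ a ∷ q ∷ r) ∎
  where
  open ↭.PermutationReasoning
  L = map (shIV t) l
  R = map (shIV t) r

consIV-↭ : ∀ t τ → consIV t τ ↭ suc t ∷ t ∷ map (shIV t) τ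
consIV-↭ t τ = ↭.↭-trans (↭.shift (suc t) (map (shIV t) τ) (t ∷ []))
  (↭.↭-prep (suc t) (subst (λ z → map (shIV t) τ ++ t ∷ [] ↭ t ∷ z) (++-identityʳ (map (shIV t) τ)) (↭.shift t (map (shIV t) τ) [])))

pins-consI : ∀ t {τ} → Linked (NotTT1 {t}) τ → pins (consI t τ) ≡ map (swapTT1 t) (pins τ)
pins-consI t {τ} adj = pins-map (swapTT1 t) τ (Linked.map swapTT1-keepsOrder adj)

pins-lift : ∀ k t τ → pins (map (lift k t) τ) ≡ map (lift k t) (pins τ)
pins-lift k t = pins-map-monotone (lift k t) (lift-<ᵇ {k} {t})

pins-consII : ∀ t l b r → b < t → t ∉ l → t ∉ r →
  pins (consII t (l ++ b ∷ t ∷ r)) ≡ map (lift 1 t) (pins (l ++ b ∷ t ∷ r))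
pins-consII t l b r b<t t∉l t∉r = begin
    pins (consII t (l ++ b ∷ t ∷ r))  ≡⟨ cong pins (consII-at t l b r b<t t∉l t∉r) ⟩
    pins (L ++ b ∷ t ∷ suc t ∷ R)     ≡⟨ pins-skip-ascent L b t (suc t) R b<t (n<1+n t) ⟩
    pins (L ++ b ∷ suc t ∷ R)         ≡⟨ cong pins (trans (map-lift-at 1 t l b t r b<t) (cong (λ z → L ++ b ∷ z ∷ R) (lift-t t))) ⟨
    pins (map (lift 1 t) (l ++ b ∷ t ∷ r)) ≡⟨ pins-lift 1 t (l ++ b ∷ t ∷ r) ⟩
    map (lift 1 t) (pins (l ++ b ∷ t ∷ r)) ∎
  where
  open ≡-Reasoning
  L = map (lift 1 t) l
  R = map (lift 1 t) r

pins-consIII : ∀ t q l a r → a < t → t ≤ q → q ∉ l → q ∉ r →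
  pins (consIII t q (l ++ a ∷ q ∷ r)) ↭ suc t ∷ map (shIV t) (pins (l ++ a ∷ q ∷ r))
pins-consIII t q l a r a<t t≤q q∉l q∉r = begin
    pins (consIII t q (l ++ a ∷ q ∷ r))                  ≡⟨ cong pins (consIII-at t q l a r a<t t≤q q∉l q∉r) ⟩
    pins (L ++ a ∷ suc t ∷ t ∷ q + 2 ∷ R)                ≡⟨ pins-insert-peak L a (suc t) t (q + 2) R (<-trans a<t (n<1+n t)) (n<1+n t) t<q+2 a<q+2 ⟩
    pins (L ++ a ∷ q + 2 ∷ []) ++ suc t ∷ pins (a ∷ q + 2 ∷ R) ↭⟨ ↭.shift (suc t) (pins (L ++ a ∷ q + 2 ∷ [])) _ ⟩
    suc t ∷ pins (L ++ a ∷ q + 2 ∷ []) ++ pins (a ∷ q + 2 ∷ R) ≡⟨ cong (suc t ∷_) (sym (pins-++ L a (q + 2) R)) ⟩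
    suc t ∷ pins (L ++ a ∷ q + 2 ∷ R)                    ≡⟨ cong (λ z → suc t ∷ pins z) (trans (map-lift-at 2 t l a q r a<t) (cong (λ u → L ++ a ∷ u ∷ R) (lift-≥ t≤q))) ⟨
    suc t ∷ pins (map (shIV t) (l ++ a ∷ q ∷ r))         ≡⟨ cong (suc t ∷_) (pins-lift 2 t (l ++ a ∷ q ∷ r)) ⟩
    suc t ∷ map (shIV t) (pins (l ++ a ∷ q ∷ r))         ∎
  where
  open ↭.PermutationReasoning
  L = map (shIV t) l
  R = map (shIV t) r
  t<q+2 : t < q + 2
  t<q+2 = ≤-<-trans t≤q (m<m+n q (s≤s z≤n))
  a<q+2 : a < q + 2
  a<q+2 = <-trans a<t t<q+2

pins-consIV : ∀ t l z → z < t → pins (consIV t (l ++ z ∷ [])) ↭ suc t ∷ map (shIV t) (pins (l ++ z ∷ []))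
pins-consIV t l z z<t = begin
    pins (consIV t (l ++ z ∷ []))                   ≡⟨ cong pins (consIV-at t l z z<t) ⟩
    pins (L ++ z ∷ suc t ∷ t ∷ [])                  ≡⟨ pins-append-peak L z (suc t) t (<-trans z<t (n<1+n t)) (n<1+n t) ⟩
    pins (L ++ z ∷ []) ++ suc t ∷ []                ↭⟨ ↭.↭-sym (↭.∷↭∷ʳ (suc t) (pins (L ++ z ∷ []))) ⟩
    suc t ∷ pins (L ++ z ∷ [])                      ≡⟨ cong (λ u → suc t ∷ pins (L ++ u ∷ [])) (lift-< z<t) ⟨
    suc t ∷ pins (L ++ shIV t z ∷ [])               ≡⟨ cong (λ u → suc t ∷ pins u) (map-++ (shIV t) l (z ∷ [])) ⟨
    suc t ∷ pins (map (shIV t) (l ++ z ∷ []))       ≡⟨ cong (suc t ∷_) (pins-lift 2 t (l ++ z ∷ [])) ⟩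
    suc t ∷ map (shIV t) (pins (l ++ z ∷ []))       ∎
  where
  open ↭.PermutationReasoning
  L = map (shIV t) l

mutual
  decodeII : ℕ → List ℕ → List ℕ
  decodeII t [] = []
  decodeII t (x ∷ r) = if x ≡ᵇ t then t ∷ decodeII-skip t r else unlift 1 t x ∷ decodeII t r

  decodeII-skip : ℕ → List ℕ → List ℕ
  decodeII-skip t [] = []
  decodeII-skip t (_ ∷ r) = decodeII t r

decodeII-consII : ∀ t τ → decodeII t (consII t τ) ≡ τ
decodeII-consII t [] = refl
decodeII-consII t (x ∷ τ) with x ≟ t
... | yes refl rewrite <ᵇ-false {x} {x} ≤-refl | ≡ᵇ-true {x} refl | ≡ᵇ-true {x} refl = cong (x ∷_) (decodeII-consII x τ)
... | no x≢t rewrite insII-≢ t x≢t | ≡ᵇ-false (lift-≢ 1 t x ≤-refl) =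
  cong₂ _∷_ (unlift-lift {1} {t} x) (decodeII-consII t τ)

consII-injective : ∀ t {a b} → consII t a ≡ consII t b → a ≡ b
consII-injective t {a} {b} e = trans (sym (decodeII-consII t a)) (trans (cong (decodeII t) e) (decodeII-consII t b))

mutual
  decodeIII : ℕ → List ℕ → List ℕ
  decodeIII t [] = []
  decodeIII t (x ∷ r) = if x ≡ᵇ suc t then decodeIII-skip t r else unlift 2 t x ∷ decodeIII t r

  decodeIII-skip : ℕ → List ℕ → List ℕ
  decodeIII-skip t [] = []
  decodeIII-skip t (_ ∷ r) = decodeIII-lower t r

  decodeIII-lower : ℕ → List ℕ → List ℕ
  decodeIII-lower t [] = []
  decodeIII-lower t (y ∷ r) = y ∸ 2 ∷ decodeIII t r

decodeIII-consIII : ∀ t q τ → t ≤ q → decodeIII t (consIII t q τ) ≡ τ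
decodeIII-consIII t q [] _ = refl
decodeIII-consIII t q (x ∷ τ) t≤q with x ≟ q
... | yes refl rewrite <ᵇ-false {x} {t} t≤q | ≡ᵇ-true {x} refl | ≡ᵇ-true {suc t} refl =
  cong₂ _∷_ (m+n∸n≡m x 2) (decodeIII-consIII t x τ t≤q)
... | no x≢q rewrite insIII-≢ t q x≢q | ≡ᵇ-false (lift-≢suc 2 t x ≤-refl) =
  cong₂ _∷_ (unlift-lift {2} {t} x) (decodeIII-consIII t q τ t≤q)

decodeIII-consIV : ∀ t τ → decodeIII t (consIV t τ) ≡ τ
decodeIII-consIV t [] rewrite ≡ᵇ-true {suc t} refl = refl
decodeIII-consIV t (x ∷ τ) rewrite ≡ᵇ-false (lift-≢suc 2 t x ≤-refl) =
  cong₂ _∷_ (unlift-lift {2} {t} x) (decodeIII-consIV t τ)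

reverse-consIII-injective : ∀ t q → t ≤ q → ∀ {a b} → reverse (consIII t q a) ≡ reverse (consIII t q b) → a ≡ b
reverse-consIII-injective t q t≤q {a} {b} e = trans (sym (decodeIII-consIII t q a t≤q))
  (trans (cong (decodeIII t) (reverse-injective {x = consIII t q a} {y = consIII t q b} e)) (decodeIII-consIII t q b t≤q))

reverse-consIV-injective : ∀ t {a b} → reverse (consIV t a) ≡ reverse (consIV t b) → a ≡ b
reverse-consIV-injective t {a} {b} e = trans (sym (decodeIII-consIV t a))
  (trans (cong (decodeIII t) (reverse-injective {x = consIV t a} {y = consIV t b} e)) (decodeIII-consIV t b))

IsPinPerm : ℕ → List ℕ → List ℕ → Set
IsPinPerm m S σ = Perm m σ × HasPins σ S

IsPinPerm-reverse : ∀ {m S σ} → IsPinPerm m S σ → IsPinPerm m S (reverse σ)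
IsPinPerm-reverse {σ = σ} (pσ , hσ) =
  Perm-resp-↭ (↭.↭-sym (↭.↭-reverse σ)) pσ ,
  λ x → mk⇔ (to (hσ x) ∘ pins-reverse⁻ σ) (pins-reverse⁺ σ ∘ from (hσ x))

IsPinPerm⇒2< : ∀ {m S σ} → IsPinPerm m S σ → ∀ {x} → x ∈ S → 2 < x
IsPinPerm⇒2< {σ = σ} (pσ , hσ) {x} x∈S with pins⇒Peak σ (from (hσ x) x∈S)
... | l , a , c , r , refl , a<x , c<x with <-cmp a c
...   | tri< a<c _ _ = ≤-<-trans (≤-trans (s≤s (proj₁ (Perm-∈⁻ pσ (∈-++⁺ʳ l (here refl))))) a<c) c<x
...   | tri> _ _ c<a = ≤-<-trans (≤-trans (s≤s (proj₁ (Perm-∈⁻ pσ (∈-++⁺ʳ l (there (there (here refl))))))) c<a) a<x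
...   | tri≈ _ refl _ = ⊥-elim (proj₂ (Unique-mid l a (x ∷ a ∷ r) (Perm⇒Unique pσ)) (there (here refl)))

maxAtEnd : ∀ {m S σ} → 1 ≤ m → IsPinPerm m S σ → m ∉ S →
  ∃ λ τ → IsPinPerm (m ∸ 1) S τ × (σ ≡ τ ++ m ∷ [] ⊎ σ ≡ m ∷ τ)
maxAtEnd {suc k} {S} _ (pσ , hσ) m∉S with ∈-∃++ (Perm-∈⁺ pσ (s≤s z≤n , ≤-refl))
... | l , r , refl = split (initLast l) r pσ hσ
  where
  m = suc k
  below : ∀ {σ xs} → Perm m σ → m ∉ xs → (∀ {x} → x ∈ xs → x ∈ σ) → All (_< m) xs
  below pσ m∉xs ⊆σ = All.tabulate λ x∈ → ≤∧≢⇒< (proj₂ (Perm-∈⁻ pσ (⊆σ x∈))) λ {refl → m∉xs x∈}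
  split : ∀ {l} → InitLast l → ∀ r → Perm m (l ++ m ∷ r) → HasPins (l ++ m ∷ r) S →
          ∃ λ τ → IsPinPerm k S τ × (l ++ m ∷ r ≡ τ ++ m ∷ [] ⊎ l ++ m ∷ r ≡ m ∷ τ)
  split [] r pσ hσ = r ,
    (from (Perm-∷-max k) pσ ,
     λ x → subst (λ z → x ∈ z ⇔ x ∈ S) (pins-∷-max m r (below pσ (proj₂ (Unique-mid [] m r (Perm⇒Unique pσ))) there)) (hσ x)) ,
    inj₂ refl
  split (l ∷ʳ′ a) [] pσ hσ = l ++ a ∷ [] ,
    (from (Perm-∷-max k) (Perm-resp-↭ (↭.↭-sym (↭.∷↭∷ʳ m (l ++ a ∷ []))) pσ) ,
     λ x → subst (λ z → x ∈ z ⇔ x ∈ S)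
             (pins-∷ʳ-max m (l ++ a ∷ []) (below pσ (proj₁ (Unique-mid (l ++ a ∷ []) m [] (Perm⇒Unique pσ))) ∈-++⁺ˡ)) (hσ x)) ,
    inj₁ refl
  split (l ∷ʳ′ a) (c ∷ r) pσ hσ = ⊥-elim (m∉S (to (hσ m)
      (subst (λ z → m ∈ pins z) (sym (++-assoc l (a ∷ []) (m ∷ c ∷ r))) (Peak⇒pins l a m c r a<m c<m))))
    where
    m∉ = Unique-mid (l ++ a ∷ []) m (c ∷ r) (Perm⇒Unique pσ)
    a<m = All.lookup (below pσ (proj₁ m∉) ∈-++⁺ˡ) (∈-++⁺ʳ l (here refl))
    c<m = All.lookup (below pσ (proj₂ m∉) (∈-++⁺ʳ (l ++ a ∷ []) ∘ there)) (here refl)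

bothEnds : ℕ → List (List ℕ) → List (List ℕ)
bothEnds m R = map (_++ m ∷ []) R ++ map (m ∷_) R

vShaped : ℕ → List (List ℕ)
vShaped zero = [] ∷ []
vShaped (suc zero) = (1 ∷ []) ∷ []
vShaped (suc (suc k)) = bothEnds (suc (suc k)) (vShaped (suc k))

-- In all these words t is immediately followed by t+1.
pairBlock : (ℕ → List ℕ → List (List ℕ)) → ℕ → ℕ → List ℕ → List (List ℕ)
pairBlock R n t T =
     map (consII t) (R (n ∸ 1) (T ++ range t (n ∸ 1)))
  ++ concatMap (λ q → map (reverse ∘ consIII t q) (R (n ∸ 2) (T ++ range t (n ∸ 2)))) (range t (n ∸ 2))
  ++ map (reverse ∘ consIV t) (R (n ∸ 2) (T ++ range t (n ∸ 2)))

atMax : (ℕ → List ℕ → List (List ℕ)) → ℕ → ℕ → List ℕ → List (List ℕ)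
atMax R n t T = map (consI t) (R n (T ++ t ∷ range (t + 2) n)) ++ pairBlock R n t T ++ map reverse (pairBlock R n t T)

P′-atMax : (ℕ → List ℕ → List (List ℕ)) → ℕ → ℕ → List ℕ → List (List ℕ)
P′-atMax R n t T =
     map (consI t) (R n (T ++ t ∷ range (t + 2) n))
  ++ map (consII t) (R (n ∸ 1) (T ++ range t (n ∸ 1)))
  ++ concatMap (λ q → map (consIII t q) (R (n ∸ 2) (T ++ range t (n ∸ 2)))) (range t (n ∸ 2))
  ++ map (consIV t) (R (n ∸ 2) (T ++ range t (n ∸ 2)))

P′f-unfold : ∀ f m s ss → P'f (suc f) m (s ∷ ss) ≡
  (if not (isPinSet (s ∷ ss)) then []
   else (if m <ᵇ maxL (s ∷ ss) then []
   else (if maxL (s ∷ ss) <ᵇ m then map (_++ m ∷ []) (P'f f (m ∸ 1) (s ∷ ss))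
   else P′-atMax (P'f f) (maxL (s ∷ ss)) (findT (maxL (s ∷ ss) ∸ 1) (s ∷ ss))
          (filterᵇ (λ x → x <ᵇ findT (maxL (s ∷ ss) ∸ 1) (s ∷ ss)) (s ∷ ss)))))
P′f-unfold f m s ss = refl

-- 𝔓_m(S), once the fuel f exceeds m + ΣS (as for P'f).
PinPermsf : ℕ → ℕ → List ℕ → List (List ℕ)
PinPermsf zero m S = []
PinPermsf (suc f) m [] = vShaped m
PinPermsf (suc f) m (s ∷ ss) =
  if not (isPinSet (s ∷ ss)) then []
  else (if m <ᵇ maxL (s ∷ ss) then []
  else (if maxL (s ∷ ss) <ᵇ m then bothEnds m (PinPermsf f (m ∸ 1) (s ∷ ss))
  else atMax (PinPermsf f) (maxL (s ∷ ss)) (findT (maxL (s ∷ ss) ∸ 1) (s ∷ ss))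
             (filterᵇ (λ x → x <ᵇ findT (maxL (s ∷ ss) ∸ 1) (s ∷ ss)) (s ∷ ss))))

length-concatMap-const : ∀ {A B : Set} (g : A → List B) {c} xs → (∀ x → length (g x) ≡ c) →
                         length (concatMap g xs) ≡ length xs * c
length-concatMap-const g [] _ = refl
length-concatMap-const g (x ∷ xs) len = trans (length-++ (g x)) (cong₂ _+_ (len x) (length-concatMap-const g xs len))

module _ (R : ℕ → List ℕ → List (List ℕ)) (n t : ℕ) (T : List ℕ) where

  private
    R₁ = R n (T ++ t ∷ range (t + 2) n)
    R₂ = R (n ∸ 1) (T ++ range t (n ∸ 1))
    R₃ = R (n ∸ 2) (T ++ range t (n ∸ 2))
    k = length (range t (n ∸ 2))

  length-pairBlock : length (pairBlock R n t T) ≡ length R₂ + (k * length R₃ + length R₃)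
  length-pairBlock = begin
    length (map (consII t) R₂ ++ IIIs ++ IVs)             ≡⟨ length-++ (map (consII t) R₂) ⟩
    length (map (consII t) R₂) + length (IIIs ++ IVs)     ≡⟨ cong₂ _+_ (length-map (consII t) R₂) (length-++ IIIs) ⟩
    length R₂ + (length IIIs + length IVs)
      ≡⟨ cong₂ (λ x y → length R₂ + (x + y))
           (length-concatMap-const (λ q → map (reverse ∘ consIII t q) R₃) (range t (n ∸ 2)) (λ q → length-map (reverse ∘ consIII t q) R₃))
           (length-map (reverse ∘ consIV t) R₃) ⟩
    length R₂ + (k * length R₃ + length R₃)               ∎
    where
    open ≡-Reasoning
    IIIs = concatMap (λ q → map (reverse ∘ consIII t q) R₃) (range t (n ∸ 2))
    IVs = map (reverse ∘ consIV t) R₃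

  length-atMax : length (atMax R n t T) ≡ length R₁ + (length (pairBlock R n t T) + length (pairBlock R n t T))
  length-atMax = begin
    length (map (consI t) R₁ ++ B ++ map reverse B)           ≡⟨ length-++ (map (consI t) R₁) ⟩
    length (map (consI t) R₁) + length (B ++ map reverse B)   ≡⟨ cong₂ _+_ (length-map (consI t) R₁) (length-++ B) ⟩
    length R₁ + (length B + length (map reverse B))           ≡⟨ cong (λ x → length R₁ + (length B + x)) (length-map reverse B) ⟩
    length R₁ + (length B + length B)                         ∎
    where
    open ≡-Reasoning
    B = pairBlock R n t T

  length-P′-atMax : length (P′-atMax R n t T) ≡ length R₁ + (length R₂ + (k * length R₃ + length R₃))
  length-P′-atMax = begin
    length (map (consI t) R₁ ++ map (consII t) R₂ ++ C₃ ++ C₄)          ≡⟨ length-++ (map (consI t) R₁) ⟩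
    length (map (consI t) R₁) + length (map (consII t) R₂ ++ C₃ ++ C₄)  ≡⟨ cong₂ _+_ (length-map (consI t) R₁) (length-++ (map (consII t) R₂)) ⟩
    length R₁ + (length (map (consII t) R₂) + length (C₃ ++ C₄))        ≡⟨ cong₂ (λ x y → length R₁ + (x + y)) (length-map (consII t) R₂) (length-++ C₃) ⟩
    length R₁ + (length R₂ + (length C₃ + length C₄))
      ≡⟨ cong₂ (λ x y → length R₁ + (length R₂ + (x + y)))
           (length-concatMap-const (λ q → map (consIII t q) R₃) (range t (n ∸ 2)) (λ q → length-map (consIII t q) R₃))
           (length-map (consIV t) R₃) ⟩
    length R₁ + (length R₂ + (k * length R₃ + length R₃))              ∎
    where
    open ≡-Reasoning
    C₃ = concatMap (λ q → map (consIII t q) R₃) (range t (n ∸ 2))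
    C₄ = map (consIV t) R₃

count-regroup : ∀ a b c k E → a * (2 * E) + ((b * E + (k * (c * E) + c * E)) + (b * E + (k * (c * E) + c * E)))
                              ≡ (a + (b + (k * c + c))) * (2 * E)
count-regroup = solve 5 (λ a b c k E →
    a :* (con 2 :* E) :+ ((b :* E :+ (k :* (c :* E) :+ c :* E)) :+ (b :* E :+ (k :* (c :* E) :+ c :* E)))
    := (a :+ (b :+ (k :* c :+ c))) :* (con 2 :* E)) refl
  where open +-*-Solver

module AtMax (s : ℕ) (ss : List ℕ) (S>2 : ∀ {x} → x ∈ s ∷ ss → 2 < x) where

  S : List ℕ
  S = s ∷ ss

  n : ℕ
  n = maxL S

  t : ℕ
  t = findT (n ∸ 1) S

  T : List ℕ
  T = filterᵇ (λ x → x <ᵇ t) S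

  S₁ S₂ S₃ : List ℕ
  S₁ = T ++ t ∷ range (t + 2) n
  S₂ = T ++ range t (n ∸ 1)
  S₃ = T ++ range t (n ∸ 2)

  n∈S : n ∈ S
  n∈S = maxL-∈ s ss

  ≤n : ∀ {x} → x ∈ S → x ≤ n
  ≤n = ≤-maxL S

  2<n : 2 < n
  2<n = S>2 n∈S

  t<n : t < n
  t<n = ≤pred⇒< (<-trans z<s 2<n) (findT-≤ (n ∸ 1) S)

  t∉S : t ∉ S
  t∉S t∈S with findT-∉ (n ∸ 1) S
  ... | inj₁ t≡0 = <⇒≱ (S>2 t∈S) (≤-trans (≤-reflexive t≡0) z≤n)
  ... | inj₂ t∉S = t∉S t∈S

  ∈S-above-t : ∀ {x} → t < x → x ≤ n → x ∈ S
  ∈S-above-t {x} t<x x≤n with m≤n⇒m<n∨m≡n x≤n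
  ... | inj₁ x<n = findT-<⇒∈ (n ∸ 1) S x t<x (suc[m]≤n⇒m≤pred[n] x<n)
  ... | inj₂ refl = n∈S

  2≤t : 2 ≤ t
  2≤t = ∉⇒≤-findT (n ∸ 1) S 2 (suc[m]≤n⇒m≤pred[n] 2<n) (λ 2∈S → <-irrefl refl (S>2 2∈S))

  1≤t : 1 ≤ t
  1≤t = ≤-trans (s≤s z≤n) 2≤t

  suc-t∈S : suc t ∈ S
  suc-t∈S = ∈S-above-t ≤-refl t<n

  ∈T⁻ : ∀ {x} → x ∈ T → x ∈ S × x < t
  ∈T⁻ p = let (x∈S , x<t) = ∈-filter⁻ (λ x → T? (x <ᵇ t)) p in x∈S , <ᵇ⇒< _ t x<t

  ∈T⁺ : ∀ {x} → x ∈ S → x < t → x ∈ T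
  ∈T⁺ x∈S x<t = ∈-filter⁺ (λ x → T? (x <ᵇ t)) x∈S (<⇒<ᵇ x<t)

  ∈T++⁻ : ∀ ys {x} → x ∈ T ++ ys → (x ∈ S × x < t) ⊎ x ∈ ys
  ∈T++⁻ ys p with ∈-++⁻ T p
  ... | inj₁ q = inj₁ (∈T⁻ q)
  ... | inj₂ q = inj₂ q

  lift∈S⇔ : ∀ k → 1 ≤ k → ∀ y → lift k t y ∈ S ⇔ y ∈ T ++ range t (n ∸ k)
  lift∈S⇔ k 1≤k y with y <? t
  ... | yes y<t rewrite lift-< {k} y<t = mk⇔ (λ y∈S → ∈-++⁺ˡ (∈T⁺ y∈S y<t)) onto
    where
    onto : y ∈ T ++ range t (n ∸ k) → y ∈ S
    onto p with ∈T++⁻ _ p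
    ... | inj₁ (y∈S , _) = y∈S
    ... | inj₂ q = ⊥-elim (<⇒≱ y<t (proj₁ (∈-range⁻ t (n ∸ k) q)))
  ... | no y≮t rewrite lift-≥ {k} (≮⇒≥ y≮t) = mk⇔ into onto
    where
    into : y + k ∈ S → y ∈ T ++ range t (n ∸ k)
    into p = ∈-++⁺ʳ T (∈-range⁺ t (n ∸ k) (≮⇒≥ y≮t) (m+n≤o⇒m≤o∸n y (≤n p)))
    onto : y ∈ T ++ range t (n ∸ k) → y + k ∈ S
    onto p with ∈T++⁻ _ p
    ... | inj₁ (_ , y<t) = ⊥-elim (y≮t y<t)
    ... | inj₂ q with ∈-range⁻ t (n ∸ k) q
    ...   | t≤y , y≤n-k = ∈S-above-t (<-≤-trans (s≤s t≤y) (subst (_≤ y + k) (+-comm y 1) (+-monoʳ-≤ y 1≤k)))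
                            (≤-trans (+-monoˡ-≤ k y≤n-k) (≤-reflexive (m∸n+n≡m (<⇒≤ k<n))))
      where
      k<n : k < n
      k<n = m∸n≢0⇒n<m λ n∸k≡0 → <⇒≱ 1≤t (≤-trans t≤y (≤-trans y≤n-k (≤-reflexive n∸k≡0)))


  swapTT1∈S⇔ : ∀ y → swapTT1 t y ∈ S ⇔ y ∈ S₁
  swapTT1∈S⇔ y with tt1View {t} y
  ... | isT refl rewrite swapTT1-t {t} = mk⇔ (λ _ → ∈-++⁺ʳ T (here refl)) (λ _ → suc-t∈S)
  ... | isSucT refl rewrite swapTT1-suc {t} = mk⇔ (λ t∈S → ⊥-elim (t∉S t∈S)) onto
    where
    onto : suc t ∈ S₁ → t ∈ S
    onto p with ∈T++⁻ _ p
    ... | inj₁ (_ , t+1<t) = ⊥-elim (<-asym t+1<t (n<1+n t))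
    ... | inj₂ (here t+1≡t) = ⊥-elim (<-irrefl (sym t+1≡t) (n<1+n t))
    ... | inj₂ (there q) = ⊥-elim (<-irrefl refl (≤-trans (≤-reflexive (+-comm 2 t)) (proj₁ (∈-range⁻ (t + 2) n q))))
  ... | isOther y≢t y≢t+1 rewrite swapTT1-other y≢t y≢t+1 = mk⇔ into onto
    where
    into : y ∈ S → y ∈ S₁
    into y∈S with <-cmp y t
    ... | tri< y<t _ _ = ∈-++⁺ˡ (∈T⁺ y∈S y<t)
    ... | tri≈ _ y≡t _ = ⊥-elim (y≢t y≡t)
    ... | tri> _ _ t<y = ∈-++⁺ʳ T (there (∈-range⁺ (t + 2) n
            (subst (_≤ y) (+-comm 2 t) (≤∧≢⇒< t<y (y≢t+1 ∘ sym))) (≤n y∈S)))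
    onto : y ∈ S₁ → y ∈ S
    onto p with ∈T++⁻ _ p
    ... | inj₁ (y∈S , _) = y∈S
    ... | inj₂ (here y≡t) = ⊥-elim (y≢t y≡t)
    ... | inj₂ (there q) = let (t+2≤y , y≤n) = ∈-range⁻ (t + 2) n q in
      ∈S-above-t (≤-trans (n≤1+n (suc t)) (≤-trans (≤-reflexive (+-comm 2 t)) t+2≤y)) y≤n

  gap₁ : ∀ x → x ∈ t ∷ [] ⇔ InGap 1 t x
  gap₁ x = mk⇔ (λ { (here refl) → ≤-refl , subst (t <_) (+-comm 1 t) (n<1+n t) })
                (λ (t≤x , x<t+1) → here (≤-antisym (s≤s⁻¹ (subst (x <_) (+-comm t 1) x<t+1)) t≤x))

  ∉gap₁ : ∀ {x} → x ≢ t → ¬ InGap 1 t x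
  ∉gap₁ x≢t g with from (gap₁ _) g
  ... | here e = x≢t e

  split₁ : Splits n (n ∸ 1) (t ∷ []) (lift 1 t)
  split₁ = lift-splits 1≤t (subst (_≤ suc n) (+-comm 1 t) (s≤s (<⇒≤ t<n))) gap₁

  gap₂ : ∀ x → x ∈ suc t ∷ t ∷ [] ⇔ InGap 2 t x
  gap₂ x = mk⇔ into onto
    where
    into : x ∈ suc t ∷ t ∷ [] → InGap 2 t x
    into (here refl) = n≤1+n t , subst (suc t <_) (+-comm 2 t) ≤-refl
    into (there (here refl)) = ≤-refl , subst (t <_) (+-comm 2 t) (≤-trans (n<1+n t) (n≤1+n (suc t)))
    onto : InGap 2 t x → x ∈ suc t ∷ t ∷ []
    onto (t≤x , x<t+2) with m≤n⇒m<n∨m≡n t≤x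
    ... | inj₂ refl = there (here refl)
    ... | inj₁ t<x = here (≤-antisym (s≤s⁻¹ (subst (x <_) (+-comm t 2) x<t+2)) t<x)

  split₂ : Splits n (n ∸ 2) (suc t ∷ t ∷ []) (lift 2 t)
  split₂ = lift-splits 1≤t (subst (_≤ suc n) (+-comm 2 t) (s≤s t<n)) gap₂

  ∉gap₂ : ∀ {x} → x ≢ t × x ≢ suc t → ¬ InGap 2 t x
  ∉gap₂ (x≢t , x≢t+1) g with from (gap₂ _) g
  ... | here e = x≢t+1 e
  ... | there (here e) = x≢t e

  Avoids : List ℕ → Set
  Avoids xs = ∀ {x} → x ∈ xs → x ≢ t × x ≢ suc t

  Avoids-reverse : ∀ {xs} → Avoids xs → Avoids (reverse xs)
  Avoids-reverse av p = av (↭.∈-resp-↭ (↭.↭-reverse _) p)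

  Avoids-∷ : ∀ {c xs} → c < t → Avoids xs → Avoids (c ∷ xs)
  Avoids-∷ c<t av (here refl) = <⇒≢ c<t , <⇒≢ (<-trans c<t (n<1+n t))
  Avoids-∷ c<t av (there p) = av p

  Avoids-outside : ∀ l W r → Unique (l ++ W ++ r) → t ∈ W → suc t ∈ W → Avoids l × Avoids r
  Avoids-outside l W r u t∈W t+1∈W =
    (λ x∈l → Unique-block l W r u t∈W (inj₁ x∈l) , Unique-block l W r u t+1∈W (inj₁ x∈l)) ,
    (λ x∈r → Unique-block l W r u t∈W (inj₂ x∈r) , Unique-block l W r u t+1∈W (inj₂ x∈r))

  unlift₁-section : ∀ {xs} → Avoids xs → map (lift 1 t) (map (unlift 1 t) xs) ≡ xs
  unlift₁-section {xs} av = map-lift-unlift xs (∉gap₁ ∘ proj₁ ∘ av)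

  t∉unlift₁ : ∀ {xs} → Avoids xs → t ∉ map (unlift 1 t) xs
  t∉unlift₁ {xs} av = ∉-map-unlift xs (∉gap₁ ∘ proj₁ ∘ av) (λ p → proj₂ (av (subst (_∈ xs) (lift-t t) p)) refl)

  unlift₂-section : ∀ {xs} → Avoids xs → map (lift 2 t) (map (unlift 2 t) xs) ≡ xs
  unlift₂-section {xs} av = map-lift-unlift xs (∉gap₂ ∘ av)

  ∉unlift₂ : ∀ {q xs} → Avoids xs → t ≤ q → q + 2 ∉ xs → q ∉ map (unlift 2 t) xs
  ∉unlift₂ {q} {xs} av t≤q q+2∉ = ∉-map-unlift xs (∉gap₂ ∘ av) (q+2∉ ∘ subst (_∈ xs) (lift-≥ t≤q))

  lift≢ext₁ : ∀ y → InRange (n ∸ 1) y → lift 1 t y ∉ t ∷ []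
  lift≢ext₁ y _ (here e) = lift-≢ 1 t y ≤-refl e

  lift≢ext₂ : ∀ y → InRange (n ∸ 2) y → lift 2 t y ∉ suc t ∷ t ∷ []
  lift≢ext₂ y _ (here e) = lift-≢suc 2 t y ≤-refl e
  lift≢ext₂ y _ (there (here e)) = lift-≢ 2 t y (s≤s z≤n) e

  S⊆lift₁ : ∀ {x} → x ∈ S → x ∈ [] ⊎ ∃ λ y → lift 1 t y ≡ x
  S⊆lift₁ {x} x∈S = inj₂ (unlift 1 t x , lift-unlift x (∉gap₁ λ {refl → t∉S x∈S}))

  S⊆lift₂ : ∀ {x} → x ∈ S → x ∈ suc t ∷ [] ⊎ ∃ λ y → lift 2 t y ≡ x
  S⊆lift₂ {x} x∈S with x ≟ suc t
  ... | yes refl = inj₁ (here refl)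
  ... | no x≢t+1 = inj₂ (unlift 2 t x , lift-unlift x (∉gap₂ ((λ {refl → t∉S x∈S}) , x≢t+1)))

  S⊆swap : ∀ {x} → x ∈ S → x ∈ [] ⊎ ∃ λ y → swapTT1 t y ≡ x
  S⊆swap {x} _ = inj₂ (swapTT1 t x , swapTT1-involutive x)

  t∈S₁ : t ∈ S₁
  t∈S₁ = ∈-++⁺ʳ T (here refl)

  t∈S₂ : t ∈ S₂
  t∈S₂ = ∈-++⁺ʳ T (∈-range⁺ t (n ∸ 1) ≤-refl (suc[m]≤n⇒m≤pred[n] t<n))

  pin⇒NotTT1 : ∀ {σ} → Unique σ → t ∈ pins σ → Linked (NotTT1 {t}) σ
  pin⇒NotTT1 {σ} u t-pin = Adjacent⇒Linked σ λ adj →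
    (λ { (refl , refl) → <-asym (n<1+n t) (pins⇒Adjacent< u t-pin (inj₁ adj)) }) ,
    (λ { (refl , refl) → <-asym (n<1+n t) (pins⇒Adjacent< u t-pin (inj₂ adj)) })

  consI-sound : ∀ {τ} → IsPinPerm n S₁ τ → IsPinPerm n S (consI t τ)
  consI-sound {τ} (pτ , hτ) =
    Perm-++-map swapTT1-injective (λ _ _ ()) (swapTT1-splits 1≤t t<n) [] pτ ,
    HasPins-transfer swapTT1∈S⇔ (consI t τ) τ (↭.↭-reflexive (pins-consI t (pin⇒NotTT1 (Perm⇒Unique pτ) (from (hτ t) t∈S₁))))
      (λ ()) S⊆swap hτ

  consII-sound : ∀ {τ} → IsPinPerm (n ∸ 1) S₂ τ → IsPinPerm n S (consII t τ)
  consII-sound {τ} (pτ , hτ) with pins⇒Peak τ (from (hτ t) t∈S₂)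
  ... | l , b , c , r , refl , b<t , _ =
    Perm-resp-↭ (↭.↭-sym (consII-at-↭ t l b (c ∷ r) b<t t∉l t∉cr))
      (Perm-++-map (lift-injective {1} {t}) lift≢ext₁ split₁ ([] ∷ []) pτ) ,
    HasPins-transfer (lift∈S⇔ 1 ≤-refl) (consII t (l ++ b ∷ t ∷ c ∷ r)) (l ++ b ∷ t ∷ c ∷ r) (↭.↭-reflexive (pins-consII t l b (c ∷ r) b<t t∉l t∉cr)) (λ ()) S⊆lift₁ hτ
    where
    t∉l = proj₁ (Unique-window l b t c r (Perm⇒Unique pτ))
    t∉cr = proj₂ (Unique-window l b t c r (Perm⇒Unique pτ))

  suc-t∷[]⊆S : ∀ {x} → x ∈ suc t ∷ [] → x ∈ S
  suc-t∷[]⊆S (here refl) = suc-t∈S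

  Unique-gap₂ : Unique (suc t ∷ t ∷ [])
  Unique-gap₂ = ((λ e → <-irrefl (sym e) (n<1+n t)) ∷ []) ∷ [] ∷ []

  range-t⊆InRange : ∀ {k x} → x ∈ range t k → InRange k x
  range-t⊆InRange {k} x∈ = let (t≤x , x≤k) = ∈-range⁻ t k x∈ in ≤-trans 1≤t t≤x , x≤k

  range-t-n-2⊆S₃ : ∀ {x} → x ∈ range t (n ∸ 2) → x ∈ S₃
  range-t-n-2⊆S₃ = ∈-++⁺ʳ T

  consIII-sound : ∀ {q τ} → q ∈ range t (n ∸ 2) → IsPinPerm (n ∸ 2) S₃ τ → IsPinPerm n S (consIII t q τ)
  consIII-sound {q} {τ} q∈ (pτ , hτ) with pins⇒Peak τ (from (hτ q) (range-t-n-2⊆S₃ q∈))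
  ... | l , a , c , r , refl , a<q , _ =
    Perm-resp-↭ (↭.↭-sym (consIII-at-↭ t q l a (c ∷ r) a<t t≤q q∉l q∉cr))
      (Perm-++-map (lift-injective {2} {t}) lift≢ext₂ split₂ Unique-gap₂ pτ) ,
    HasPins-transfer (lift∈S⇔ 2 (s≤s z≤n)) (consIII t q (l ++ a ∷ q ∷ c ∷ r)) (l ++ a ∷ q ∷ c ∷ r)
      (pins-consIII t q l a (c ∷ r) a<t t≤q q∉l q∉cr) suc-t∷[]⊆S S⊆lift₂ hτ
    where
    u = Perm⇒Unique pτ
    t≤q = proj₁ (∈-range⁻ t (n ∸ 2) q∈)
    q∉l = proj₁ (Unique-window l a q c r u)
    q∉cr = proj₂ (Unique-window l a q c r u)
    a<t : a < t
    a<t with a <? t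
    ... | yes a<t = a<t
    ... | no a≮t = ⊥-elim (<-asym a<q (pins⇒Adjacent< u a-pin (inj₁ (l , c ∷ r , refl))))
      where
      a-pin : a ∈ pins (l ++ a ∷ q ∷ c ∷ r)
      a-pin = from (hτ a) (range-t-n-2⊆S₃ (∈-range⁺ t (n ∸ 2) (≮⇒≥ a≮t) (≤-trans (<⇒≤ a<q) (proj₂ (∈-range⁻ t (n ∸ 2) q∈)))))

  consIV-sound : ∀ {τ} → IsPinPerm (n ∸ 2) S₃ τ → IsPinPerm n S (consIV t τ)
  consIV-sound {τ} (pτ , hτ) with initLast τ | Perm-∈⁺ pτ (≤-refl , m+n≤o⇒m≤o∸n 1 (subst (_≤ n) (+-comm 1 2) 2<n))
  ... | l ∷ʳ′ z | _ =
    Perm-resp-↭ (↭.↭-sym (consIV-↭ t (l ++ z ∷ [])))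
      (Perm-++-map (lift-injective {2} {t}) lift≢ext₂ split₂ Unique-gap₂ pτ) ,
    HasPins-transfer (lift∈S⇔ 2 (s≤s z≤n)) (consIV t (l ++ z ∷ [])) (l ++ z ∷ [])
      (pins-consIV t l z z<t) suc-t∷[]⊆S S⊆lift₂ hτ
    where
    z<t : z < t
    z<t with z <? t
    ... | yes z<t = z<t
    ... | no z≮t = ⊥-elim (last∉pins l z (Perm⇒Unique pτ) refl
            (from (hτ z) (range-t-n-2⊆S₃ (∈-range⁺ t (n ∸ 2) (≮⇒≥ z≮t) (proj₂ (Perm-∈⁻ pτ (∈-++⁺ʳ l (here refl))))))))

  consI-sound⁻ : ∀ {τ} → Linked (NotTT1 {t}) τ → IsPinPerm n S (consI t τ) → IsPinPerm n S₁ τ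
  consI-sound⁻ {τ} adj (pσ , hσ) =
    Perm-++-map⁻ swapTT1-injective (λ _ _ ()) (swapTT1-splits 1≤t t<n) pσ ,
    HasPins-transfer⁻ swapTT1∈S⇔ (consI t τ) τ (↭.↭-reflexive (pins-consI t adj)) (λ _ ()) swapTT1-injective hσ

  consII-sound⁻ : ∀ l b r → b < t → t ∉ l → t ∉ r →
    IsPinPerm n S (consII t (l ++ b ∷ t ∷ r)) → IsPinPerm (n ∸ 1) S₂ (l ++ b ∷ t ∷ r)
  consII-sound⁻ l b r b<t t∉l t∉r (pσ , hσ) =
    Perm-++-map⁻ (lift-injective {1} {t}) lift≢ext₁ split₁ (Perm-resp-↭ (consII-at-↭ t l b r b<t t∉l t∉r) pσ) ,
    HasPins-transfer⁻ (lift∈S⇔ 1 ≤-refl) (consII t (l ++ b ∷ t ∷ r)) (l ++ b ∷ t ∷ r)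
      (↭.↭-reflexive (pins-consII t l b r b<t t∉l t∉r)) (λ _ ()) (lift-injective {1} {t}) hσ

  consIII-sound⁻ : ∀ q l a r → a < t → t ≤ q → q ∉ l → q ∉ r →
    IsPinPerm n S (consIII t q (l ++ a ∷ q ∷ r)) → IsPinPerm (n ∸ 2) S₃ (l ++ a ∷ q ∷ r)
  consIII-sound⁻ q l a r a<t t≤q q∉l q∉r (pσ , hσ) =
    Perm-++-map⁻ (lift-injective {2} {t}) lift≢ext₂ split₂ (Perm-resp-↭ (consIII-at-↭ t q l a r a<t t≤q q∉l q∉r) pσ) ,
    HasPins-transfer⁻ (lift∈S⇔ 2 (s≤s z≤n)) (consIII t q (l ++ a ∷ q ∷ r)) (l ++ a ∷ q ∷ r)
      (pins-consIII t q l a r a<t t≤q q∉l q∉r) (λ y → λ { (here e) → lift-≢suc 2 t y ≤-refl e }) (lift-injective {2} {t}) hσ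

  consIV-sound⁻ : ∀ l z → z < t → IsPinPerm n S (consIV t (l ++ z ∷ [])) → IsPinPerm (n ∸ 2) S₃ (l ++ z ∷ [])
  consIV-sound⁻ l z z<t (pσ , hσ) =
    Perm-++-map⁻ (lift-injective {2} {t}) lift≢ext₂ split₂ (Perm-resp-↭ (consIV-↭ t (l ++ z ∷ [])) pσ) ,
    HasPins-transfer⁻ (lift∈S⇔ 2 (s≤s z≤n)) (consIV t (l ++ z ∷ [])) (l ++ z ∷ [])
      (pins-consIV t l z z<t) (λ y → λ { (here e) → lift-≢suc 2 t y ≤-refl e }) (lift-injective {2} {t}) hσ

  consI-NotTT1 : ∀ {τ} → IsPinPerm n S₁ τ → Linked (NotTT1 {t}) (consI t τ)
  consI-NotTT1 (pτ , hτ) = Linked.map⁺ (Linked.map NotTT1-swapTT1 (pin⇒NotTT1 (Perm⇒Unique pτ) (from (hτ t) t∈S₁)))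

  consII-shape : ∀ {τ} → IsPinPerm (n ∸ 1) S₂ τ →
    Adjacent (consII t τ) t (suc t) × ∃ λ b → b < t × Adjacent (consII t τ) b t
  consII-shape {τ} (pτ , hτ) with pins⇒Peak τ (from (hτ t) t∈S₂)
  ... | l , b , c , r , refl , b<t , _ =
    (L ++ b ∷ [] , R , trans eq (sym (++-assoc L (b ∷ []) (t ∷ suc t ∷ R)))) , b , b<t , (L , suc t ∷ R , eq)
    where
    L = map (lift 1 t) l
    R = map (lift 1 t) (c ∷ r)
    eq : consII t (l ++ b ∷ t ∷ c ∷ r) ≡ L ++ b ∷ t ∷ suc t ∷ R
    eq = consII-at t l b (c ∷ r) b<t (proj₁ (Unique-window l b t c r (Perm⇒Unique pτ)))
                                     (proj₂ (Unique-window l b t c r (Perm⇒Unique pτ)))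

  consIII-shape : ∀ {q τ} → q ∈ range t (n ∸ 2) → Perm (n ∸ 2) τ →
    Adjacent (reverse (consIII t q τ)) t (suc t) × Adjacent (reverse (consIII t q τ)) (q + 2) t
  consIII-shape {q} {τ} q∈ pτ with ∈-∃++ (Perm-∈⁺ pτ (range-t⊆InRange q∈))
  ... | l , r , refl =
    Adjacent-reverse (consIII t q (l ++ q ∷ r)) (L , q + 2 ∷ R , eq) ,
    Adjacent-reverse (consIII t q (l ++ q ∷ r)) (L ++ suc t ∷ [] , R , trans eq (sym (++-assoc L (suc t ∷ []) (t ∷ q + 2 ∷ R))))
    where
    L = map (shIV t) l
    R = map (shIV t) r
    eq : consIII t q (l ++ q ∷ r) ≡ L ++ suc t ∷ t ∷ q + 2 ∷ R
    eq = consIII-split t q l r (proj₁ (∈-range⁻ t (n ∸ 2) q∈))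
           (proj₁ (Unique-mid l q r (Perm⇒Unique pτ))) (proj₂ (Unique-mid l q r (Perm⇒Unique pτ)))

  consIV-shape : ∀ τ → reverse (consIV t τ) ≡ t ∷ suc t ∷ reverse (map (shIV t) τ)
  consIV-shape τ = reverse-++ (map (shIV t) τ) (suc t ∷ t ∷ [])

  module _ (R : ℕ → List ℕ → List (List ℕ)) where

    IIs IIIs IVs : List (List ℕ)
    IIs = map (consII t) (R (n ∸ 1) S₂)
    IIIs = concatMap (λ q → map (reverse ∘ consIII t q) (R (n ∸ 2) S₃)) (range t (n ∸ 2))
    IVs = map (reverse ∘ consIV t) (R (n ∸ 2) S₃)

    module _ (R-sound : ∀ {m′ S′ τ} → τ ∈ R m′ S′ → IsPinPerm m′ S′ τ) where

      IIs-facts : ∀ {σ} → σ ∈ IIs → IsPinPerm n S σ × Adjacent σ t (suc t) × ∃ λ b → b < t × Adjacent σ b t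
      IIs-facts p with ∈-map⁻ (consII t) p
      ... | τ , τ∈ , refl = consII-sound (R-sound τ∈) , consII-shape (R-sound τ∈)

      IIIs-block-facts : ∀ {q σ} → q ∈ range t (n ∸ 2) → σ ∈ map (reverse ∘ consIII t q) (R (n ∸ 2) S₃) →
        IsPinPerm n S σ × Adjacent σ t (suc t) × Adjacent σ (q + 2) t
      IIIs-block-facts q∈ p with ∈-map⁻ (reverse ∘ consIII t _) p
      ... | τ , τ∈ , refl = IsPinPerm-reverse (consIII-sound q∈ (R-sound τ∈)) , consIII-shape q∈ (proj₁ (R-sound τ∈))

      IIIs-facts : ∀ {σ} → σ ∈ IIIs →
        IsPinPerm n S σ × Adjacent σ t (suc t) × ∃ λ q → q ∈ range t (n ∸ 2) × Adjacent σ (q + 2) t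
      IIIs-facts p with find (∈-concatMap⁻ (λ q → map (reverse ∘ consIII t q) (R (n ∸ 2) S₃)) {xs = range t (n ∸ 2)} p)
      ... | q , q∈ , p′ = let (hσ , t,t+1 , q+2,t) = IIIs-block-facts q∈ p′ in hσ , t,t+1 , q , q∈ , q+2,t

      IVs-facts : ∀ {σ} → σ ∈ IVs → IsPinPerm n S σ × Adjacent σ t (suc t) × ∃ λ r → σ ≡ t ∷ r
      IVs-facts p with ∈-map⁻ (reverse ∘ consIV t) p
      ... | τ , τ∈ , refl = IsPinPerm-reverse (consIV-sound (R-sound τ∈)) , ([] , _ , consIV-shape τ) , _ , consIV-shape τ

      pairBlock-facts : ∀ {σ} → σ ∈ pairBlock R n t T → IsPinPerm n S σ × Adjacent σ t (suc t)
      pairBlock-facts p with ∈-++⁻ IIs p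
      ... | inj₁ q = let (hσ , t,t+1 , _) = IIs-facts q in hσ , t,t+1
      ... | inj₂ q with ∈-++⁻ IIIs q
      ...   | inj₁ w = let (hσ , t,t+1 , _) = IIIs-facts w in hσ , t,t+1
      ...   | inj₂ w = let (hσ , t,t+1 , _) = IVs-facts w in hσ , t,t+1

      atMax-sound : ∀ {σ} → σ ∈ atMax R n t T → IsPinPerm n S σ
      atMax-sound p with ∈-++⁻ (map (consI t) (R n S₁)) p
      ... | inj₁ q with ∈-map⁻ (consI t) q
      ...   | τ , τ∈ , refl = consI-sound (R-sound τ∈)
      atMax-sound p | inj₂ q with ∈-++⁻ (pairBlock R n t T) q
      ... | inj₁ w = proj₁ (pairBlock-facts w)
      ... | inj₂ w with ∈-map⁻ reverse w
      ...   | β , β∈ , refl = IsPinPerm-reverse (proj₁ (pairBlock-facts β∈))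

      module _ (R-unique : ∀ m′ S′ → Unique (R m′ S′)) where

        IIIs-unique : Unique IIIs
        IIIs-unique = Unique-concatMap _ (range t (n ∸ 2)) (sorted⇒unique (range-sorted t (n ∸ 2)))
          (λ q∈ → Unique.map⁺ (reverse-consIII-injective t _ (proj₁ (∈-range⁻ t (n ∸ 2) q∈))) (R-unique _ _))
          λ q∈ q′∈ p p′ → let (hσ , _ , q+2,t) = IIIs-block-facts q∈ p ; (_ , _ , q′+2,t) = IIIs-block-facts q′∈ p′ in
                         +-cancelʳ-≡ 2 _ _ (Adjacent-pred-unique _ (Perm⇒Unique (proj₁ hσ)) q+2,t q′+2,t)

        pairBlock-unique : Unique (pairBlock R n t T)
        pairBlock-unique =
          Unique.++⁺ (Unique.map⁺ (consII-injective t) (R-unique _ _))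
            (Unique.++⁺ IIIs-unique (Unique.map⁺ (reverse-consIV-injective t) (R-unique _ _)) III∩IV)
            II∩rest
          where
          III∩IV : Disjoint IIIs IVs
          III∩IV (p , p′) = let ((pσ , _) , _ , _ , _ , q+2,t) = IIIs-facts p ; (_ , _ , r , eq) = IVs-facts p′ in
            Adjacent-not-first _ r (Perm⇒Unique pσ) q+2,t eq
          II∩rest : Disjoint IIs (IIIs ++ IVs)
          II∩rest (p , p′) with IIs-facts p | ∈-++⁻ IIIs p′
          ... | (pσ , _) , _ , b , b<t , b,t | inj₁ w = let (_ , _ , q , q∈ , q+2,t) = IIIs-facts w in
            <⇒≱ b<t (≤-trans (proj₁ (∈-range⁻ t (n ∸ 2) q∈))
                     (≤-trans (m≤m+n q 2) (≤-reflexive (sym (Adjacent-pred-unique _ (Perm⇒Unique pσ) b,t q+2,t)))))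
          ... | (pσ , _) , _ , b , b<t , b,t | inj₂ w = let (_ , _ , r , eq) = IVs-facts w in
            Adjacent-not-first _ r (Perm⇒Unique pσ) b,t eq

        atMax-unique : Unique (atMax R n t T)
        atMax-unique =
          Unique.++⁺ (Unique.map⁺ (consI-injective t) (R-unique _ _))
            (Unique.++⁺ pairBlock-unique (Unique.map⁺ reverse-injective pairBlock-unique) B∩Bʳ) I∩rest
          where
          B∩Bʳ : Disjoint (pairBlock R n t T) (map reverse (pairBlock R n t T))
          B∩Bʳ (p , p′) with ∈-map⁻ reverse p′
          ... | β , β∈ , refl = let ((pσ , _) , t,t+1) = pairBlock-facts p in
            Adjacent-both-ways _ (Perm⇒Unique pσ) t,t+1 (Adjacent-reverse β (proj₂ (pairBlock-facts β∈)))
              (λ e → <-irrefl e (n<1+n t))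
          I∩rest : Disjoint (map (consI t) (R n S₁)) (pairBlock R n t T ++ map reverse (pairBlock R n t T))
          I∩rest (p , p′) with ∈-map⁻ (consI t) p
          ... | τ , τ∈ , refl with ∈-++⁻ (pairBlock R n t T) p′
          ...   | inj₁ w = proj₁ (Linked⇒Adjacent (consI-NotTT1 (R-sound τ∈)) (proj₂ (pairBlock-facts w))) (refl , refl)
          ...   | inj₂ w with ∈-map⁻ reverse w
          ...     | β , β∈ , e = proj₂ (Linked⇒Adjacent (consI-NotTT1 (R-sound τ∈))
                                   (subst (λ z → Adjacent z (suc t) t) (sym e) (Adjacent-reverse β (proj₂ (pairBlock-facts β∈)))))
                                   (refl , refl)

  module _ (S-sorted : Sorted S) where

    T<t : ∀ {x} → x ∈ T → x < t
    T<t = proj₂ ∘ ∈T⁻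

    T++-sorted : ∀ {ys} → Sorted ys → (∀ {y} → y ∈ ys → t ≤ y) → Sorted (T ++ ys)
    T++-sorted ys-sorted t≤ys = AllPairs.++⁺ (AllPairs.filter⁺ (λ x → T? (x <ᵇ t)) S-sorted) ys-sorted
      (All.tabulate λ x∈T → All.tabulate λ y∈ys → <-≤-trans (T<t x∈T) (t≤ys y∈ys))

    n≡1+[n-1] : n ≡ suc (n ∸ 1)
    n≡1+[n-1] = +-∸-assoc 1 (<-trans z<s 2<n)

    n-1≡1+[n-2] : n ∸ 1 ≡ suc (n ∸ 2)
    n-1≡1+[n-2] = +-∸-assoc 1 (<⇒≤ 2<n)

    S≡T++range : S ≡ T ++ range (suc t) n
    S≡T++range = Sorted-≡ S-sorted (T++-sorted (range-sorted (suc t) n) (λ y∈ → <⇒≤ (proj₁ (∈-range⁻ (suc t) n y∈)))) same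
      where
      same : ∀ x → x ∈ S ⇔ x ∈ T ++ range (suc t) n
      same x = mk⇔ into onto
        where
        into : x ∈ S → x ∈ T ++ range (suc t) n
        into x∈S with <-cmp x t
        ... | tri< x<t _ _ = ∈-++⁺ˡ (∈T⁺ x∈S x<t)
        ... | tri≈ _ refl _ = ⊥-elim (t∉S x∈S)
        ... | tri> _ _ t<x = ∈-++⁺ʳ T (∈-range⁺ (suc t) n t<x (≤n x∈S))
        onto : x ∈ T ++ range (suc t) n → x ∈ S
        onto p with ∈T++⁻ _ p
        ... | inj₁ (x∈S , _) = x∈S
        ... | inj₂ q = let (t<x , x≤n) = ∈-range⁻ (suc t) n q in ∈S-above-t t<x x≤n

    range-above-t≡map-suc : range (suc t) n ≡ map suc (range t (n ∸ 1))
    range-above-t≡map-suc = trans (cong (range (suc t)) n≡1+[n-1]) (sym (map-suc-range t (n ∸ 1)))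

    range-above-t≡∷ : range (suc t) n ≡ suc t ∷ range (t + 2) n
    range-above-t≡∷ = trans (range-cons (suc t) n t<n) (cong (λ z → suc t ∷ range z n) (+-comm 2 t))

    range-t+2≡map-+2 : range (t + 2) n ≡ map (λ x → suc (suc x)) (range t (n ∸ 2))
    range-t+2≡map-+2 = begin
      range (t + 2) n                                  ≡⟨ cong₂ range (+-comm t 2) (trans n≡1+[n-1] (cong suc n-1≡1+[n-2])) ⟩
      range (suc (suc t)) (suc (suc (n ∸ 2)))          ≡⟨ map-suc-range (suc t) (suc (n ∸ 2)) ⟨
      map suc (range (suc t) (suc (n ∸ 2)))            ≡⟨ cong (map suc) (map-suc-range t (n ∸ 2)) ⟨
      map suc (map suc (range t (n ∸ 2)))              ≡⟨ map-∘ (range t (n ∸ 2)) ⟨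
      map (λ x → suc (suc x)) (range t (n ∸ 2))        ∎
      where open ≡-Reasoning

    S≡S₁-with-suc-t : S ≡ T ++ suc t ∷ range (t + 2) n
    S≡S₁-with-suc-t = trans S≡T++range (cong (T ++_) range-above-t≡∷)

    S≡mapsuc : S ≡ T ++ map suc (range t (n ∸ 1))
    S≡mapsuc = trans S≡T++range (cong (T ++_) range-above-t≡map-suc)

    S₂≡S₃++ : S₂ ≡ S₃ ++ n ∸ 1 ∷ []
    S₂≡S₃++ = begin
      T ++ range t (n ∸ 1)                        ≡⟨ cong (λ z → T ++ range t z) n-1≡1+[n-2] ⟩
      T ++ range t (suc (n ∸ 2))                  ≡⟨ cong (T ++_) (range-snoc t (n ∸ 2) (≤-trans (suc[m]≤n⇒m≤pred[n] t<n) (≤-reflexive n-1≡1+[n-2]))) ⟩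
      T ++ range t (n ∸ 2) ++ suc (n ∸ 2) ∷ []    ≡⟨ ++-assoc T (range t (n ∸ 2)) _ ⟨
      S₃ ++ suc (n ∸ 2) ∷ []                      ≡⟨ cong (λ z → S₃ ++ z ∷ []) n-1≡1+[n-2] ⟨
      S₃ ++ n ∸ 1 ∷ []                            ∎
      where open ≡-Reasoning

    S₁-sorted : Sorted S₁
    S₁-sorted = T++-sorted (All.tabulate t<range ∷ range-sorted (t + 2) n) λ { (here refl) → ≤-refl ; (there y∈) → <⇒≤ (t<range y∈) }
      where
      t<range : ∀ {y} → y ∈ range (t + 2) n → t < y
      t<range y∈ = ≤-trans (n≤1+n (suc t)) (≤-trans (≤-reflexive (+-comm 2 t)) (proj₁ (∈-range⁻ (t + 2) n y∈)))

    S₂-sorted : Sorted S₂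
    S₂-sorted = T++-sorted (range-sorted t (n ∸ 1)) (proj₁ ∘ ∈-range⁻ t (n ∸ 1))

    S₃-sorted : Sorted S₃
    S₃-sorted = T++-sorted (range-sorted t (n ∸ 2)) (proj₁ ∘ ∈-range⁻ t (n ∸ 2))

    length-S₁ : length S₁ ≡ length S
    length-S₁ = trans (length-++ T) (sym (trans (cong length S≡S₁-with-suc-t) (length-++ T)))

    length-S₂ : length S₂ ≡ length S
    length-S₂ = begin
      length (T ++ range t (n ∸ 1))                ≡⟨ length-++ T ⟩
      length T + length (range t (n ∸ 1))          ≡⟨ cong (length T +_) (length-map suc (range t (n ∸ 1))) ⟨
      length T + length (map suc (range t (n ∸ 1))) ≡⟨ length-++ T ⟨
      length (T ++ map suc (range t (n ∸ 1)))      ≡⟨ cong length S≡mapsuc ⟨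
      length S                                     ∎
      where open ≡-Reasoning

    length-S₃ : suc (length S₃) ≡ length S
    length-S₃ = trans (trans (+-comm 1 (length S₃)) (sym (length-++ S₃))) (trans (cong length (sym S₂≡S₃++)) length-S₂)

    S₁≤S : Pointwise _≤_ S₁ S
    S₁≤S = subst (Pointwise _≤_ S₁) (sym S≡S₁-with-suc-t) (Pointwise.++⁺ (Pointwise.refl ≤-refl) (n≤1+n t ∷ Pointwise.refl ≤-refl))

    S₂≤S : Pointwise _≤_ S₂ S
    S₂≤S = subst (Pointwise _≤_ S₂) (sym S≡mapsuc) (Pointwise.++⁺ (Pointwise.refl ≤-refl) (≤-map-suc (range t (n ∸ 1))))

    decreasing₁ : n + sum S₁ < n + sum S
    decreasing₁ = +-monoʳ-< n (begin-strict
      sum (T ++ t ∷ range (t + 2) n)             ≡⟨ sum-++ T _ ⟩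
      sum T + (t + sum (range (t + 2) n))        <⟨ +-monoʳ-< (sum T) (+-monoˡ-< (sum (range (t + 2) n)) (n<1+n t)) ⟩
      sum T + (suc t + sum (range (t + 2) n))    ≡⟨ sum-++ T _ ⟨
      sum (T ++ suc t ∷ range (t + 2) n)         ≡⟨ cong sum S≡S₁-with-suc-t ⟨
      sum S                                      ∎)
      where open ≤-Reasoning

    decreasing₂ : n ∸ 1 + sum S₂ < n + sum S
    decreasing₂ = +-mono-<-≤ (≤pred⇒< (<-trans z<s 2<n) ≤-refl) (sum-mono S₂≤S)

    decreasing₃ : n ∸ 2 + sum S₃ < n + sum S
    decreasing₃ = +-mono-<-≤ (≤-<-trans (∸-monoʳ-≤ n (s≤s z≤n)) (≤pred⇒< (<-trans z<s 2<n) ≤-refl))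
      (≤-trans (subst (sum S₃ ≤_) (trans (sym (sum-++ S₃ (n ∸ 1 ∷ []))) (cong sum (sym S₂≡S₃++))) (m≤m+n (sum S₃) _))
               (sum-mono S₂≤S))

    isPinSet-S₁ : isPinSet S₁ ≡ true → isPinSet S ≡ true
    isPinSet-S₁ = isPinFrom-mono 1 S₁≤S

    isPinSet-S₂ : isPinSet S₂ ≡ true → isPinSet S ≡ true
    isPinSet-S₂ = isPinFrom-mono 1 S₂≤S

    isPinSet-S₃ : isPinSet S₃ ≡ true → isPinSet S ≡ true
    isPinSet-S₃ pin₃ = begin
      isPinFrom 1 S                                              ≡⟨ cong (isPinFrom 1) S≡S₁-with-suc-t ⟩
      isPinFrom 1 (T ++ suc t ∷ range (t + 2) n)                 ≡⟨ isPinFrom-++ 1 T _ ⟩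
      isPinFrom 1 T ∧ ((2 * j <ᵇ suc t) ∧ isPinFrom (suc j) (range (t + 2) n))
        ≡⟨ cong₂ (λ a b → a ∧ (b ∧ isPinFrom (suc j) (range (t + 2) n))) pinT (<ᵇ-true (s≤s (isPinSet-bound T pinT T<t 2≤t))) ⟩
      isPinFrom (suc j) (range (t + 2) n)                        ≡⟨ cong (isPinFrom (suc j)) range-t+2≡map-+2 ⟩
      isPinFrom (suc j) (map (λ x → suc (suc x)) (range t (n ∸ 2))) ≡⟨ isPinFrom-map-+2 j (range t (n ∸ 2)) ⟩
      isPinFrom j (range t (n ∸ 2))                              ≡⟨ proj₂ (∧-true⁻ (trans (sym (isPinFrom-++ 1 T _)) pin₃)) ⟩
      true                                                       ∎
      where
      open ≡-Reasoning
      j = 1 + length T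
      pinT : isPinFrom 1 T ≡ true
      pinT = proj₁ (∧-true⁻ (trans (sym (isPinFrom-++ 1 T _)) pin₃))

    module _ (R : ℕ → List ℕ → List (List ℕ))
             (R-complete : ∀ {m′ S′ τ} → Sorted S′ → m′ + sum S′ < n + sum S → IsPinPerm m′ S′ τ → τ ∈ R m′ S′)
             (R⇒pin : ∀ {m′ S′ τ} → τ ∈ R m′ S′ → isPinSet S′ ≡ true) where

      ∈Is : ∀ l a c r → IsPinPerm n S (l ++ a ∷ suc t ∷ c ∷ r) → a ≢ t → c ≢ t →
            isPinSet S ≡ true × l ++ a ∷ suc t ∷ c ∷ r ∈ map (consI t) (R n S₁)
      ∈Is l a c r hσ a≢t c≢t = isPinSet-S₁ (R⇒pin τ∈) ,
        subst (_∈ map (consI t) (R n S₁)) (consI-involutive t σ) (∈-map⁺ (consI t) τ∈)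
        where
        σ = l ++ a ∷ suc t ∷ c ∷ r
        u = Perm⇒Unique (proj₁ hσ)
        σ-NotTT1 : Linked (NotTT1 {t}) σ
        σ-NotTT1 = Adjacent⇒Linked σ λ adj →
          (λ { (refl , refl) → a≢t (Adjacent-pred-unique σ u (l , c ∷ r , refl) adj) }) ,
          (λ { (refl , refl) → c≢t (Adjacent-succ-unique σ u (l ++ a ∷ [] , r , sym (++-assoc l (a ∷ []) _)) adj) })
        τ∈ : consI t σ ∈ R n S₁
        τ∈ = R-complete S₁-sorted decreasing₁
               (consI-sound⁻ (Linked.map⁺ (Linked.map NotTT1-swapTT1 σ-NotTT1))
                 (subst (IsPinPerm n S) (sym (consI-involutive t σ)) hσ))

      ∈IIs : ∀ l b c r → IsPinPerm n S (l ++ b ∷ t ∷ suc t ∷ c ∷ r) → b < t → c < t →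
             isPinSet S ≡ true × l ++ b ∷ t ∷ suc t ∷ c ∷ r ∈ IIs R
      ∈IIs l b c r hσ b<t c<t = isPinSet-S₂ (R⇒pin τ∈) , subst (_∈ IIs R) eq (∈-map⁺ (consII t) τ∈)
        where
        av = Avoids-outside l (b ∷ t ∷ suc t ∷ c ∷ []) r (Perm⇒Unique (proj₁ hσ)) (there (here refl)) (there (there (here refl)))
        av-l = proj₁ av
        av-cr = Avoids-∷ c<t (proj₂ av)
        L = map (unlift 1 t) l
        C = map (unlift 1 t) (c ∷ r)
        eq : consII t (L ++ b ∷ t ∷ C) ≡ l ++ b ∷ t ∷ suc t ∷ c ∷ r
        eq = trans (consII-at t L b C b<t (t∉unlift₁ av-l) (t∉unlift₁ av-cr))
                   (cong₂ (λ x y → x ++ b ∷ t ∷ suc t ∷ y) (unlift₁-section av-l) (unlift₁-section av-cr))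
        τ∈ : L ++ b ∷ t ∷ C ∈ R (n ∸ 1) S₂
        τ∈ = R-complete S₂-sorted decreasing₂
               (consII-sound⁻ L b C b<t (t∉unlift₁ av-l) (t∉unlift₁ av-cr) (subst (IsPinPerm n S) (sym eq) hσ))

      ∈IIIs : ∀ l b c r → IsPinPerm n S (l ++ b ∷ t ∷ suc t ∷ c ∷ r) → suc t < b → c < t →
              isPinSet S ≡ true × l ++ b ∷ t ∷ suc t ∷ c ∷ r ∈ IIIs R
      ∈IIIs l b c r hσ t+1<b c<t = isPinSet-S₃ (R⇒pin τ∈) ,
        subst (_∈ IIIs R) (trans (cong reverse eq) (reverse-involutive σ))
          (∈-concatMap⁺ (λ q → map (reverse ∘ consIII t q) (R (n ∸ 2) S₃)) (lose q∈ (∈-map⁺ (reverse ∘ consIII t q) τ∈)))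
        where
        σ = l ++ b ∷ t ∷ suc t ∷ c ∷ r
        W = b ∷ t ∷ suc t ∷ c ∷ []
        u = Perm⇒Unique (proj₁ hσ)
        av = Avoids-outside l W r u (there (here refl)) (there (there (here refl)))
        q = b ∸ 2
        q+2≡b : q + 2 ≡ b
        q+2≡b = m∸n+n≡m (≤-trans (s≤s (s≤s z≤n)) t+1<b)
        t≤q : t ≤ q
        t≤q = m+n≤o⇒m≤o∸n t (subst (_≤ b) (+-comm 2 t) t+1<b)
        q∈ : q ∈ range t (n ∸ 2)
        q∈ = ∈-range⁺ t (n ∸ 2) t≤q (∸-monoˡ-≤ 2 (proj₂ (Perm-∈⁻ (proj₁ hσ) (∈-++⁺ʳ l (here refl)))))
        b∉ : ∀ {xs} → xs ≡ l ⊎ xs ≡ r → q + 2 ∉ reverse xs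
        b∉ side p = Unique-block l W r u (here refl) (case side (↭.∈-resp-↭ (↭.↭-reverse _) p)) q+2≡b
          where
          case : ∀ {xs x} → xs ≡ l ⊎ xs ≡ r → x ∈ xs → x ∈ l ⊎ x ∈ r
          case (inj₁ refl) = inj₁
          case (inj₂ refl) = inj₂
        A = map (unlift 2 t) (reverse r)
        B = map (unlift 2 t) (reverse l)
        q∉A = ∉unlift₂ (Avoids-reverse (proj₂ av)) t≤q (b∉ (inj₂ refl))
        q∉B = ∉unlift₂ (Avoids-reverse (proj₁ av)) t≤q (b∉ (inj₁ refl))
        eq : consIII t q (A ++ c ∷ q ∷ B) ≡ reverse σ
        eq = begin
          consIII t q (A ++ c ∷ q ∷ B)                           ≡⟨ consIII-at t q A c B c<t t≤q q∉A q∉B ⟩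
          map (shIV t) A ++ c ∷ suc t ∷ t ∷ q + 2 ∷ map (shIV t) B
            ≡⟨ cong₂ (λ x y → x ++ c ∷ suc t ∷ t ∷ q + 2 ∷ y) (unlift₂-section (Avoids-reverse (proj₂ av)))
                                                             (unlift₂-section (Avoids-reverse (proj₁ av))) ⟩
          reverse r ++ c ∷ suc t ∷ t ∷ q + 2 ∷ reverse l          ≡⟨ cong (λ z → reverse r ++ c ∷ suc t ∷ t ∷ z ∷ reverse l) q+2≡b ⟩
          reverse r ++ c ∷ suc t ∷ t ∷ b ∷ reverse l              ≡⟨ reverse-sandwich l W r ⟨
          reverse σ                                               ∎
          where open ≡-Reasoning
        τ∈ : A ++ c ∷ q ∷ B ∈ R (n ∸ 2) S₃
        τ∈ = R-complete S₃-sorted decreasing₃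
               (consIII-sound⁻ q A c B c<t t≤q q∉A q∉B (subst (IsPinPerm n S) (sym eq) (IsPinPerm-reverse hσ)))

      ∈IVs : ∀ c r → IsPinPerm n S (t ∷ suc t ∷ c ∷ r) → c < t →
             isPinSet S ≡ true × t ∷ suc t ∷ c ∷ r ∈ IVs R
      ∈IVs c r hσ c<t = isPinSet-S₃ (R⇒pin τ∈) ,
        subst (_∈ IVs R) (trans (cong reverse eq) (reverse-involutive σ)) (∈-map⁺ (reverse ∘ consIV t) τ∈)
        where
        σ = t ∷ suc t ∷ c ∷ r
        av = Avoids-reverse (proj₂ (Avoids-outside [] (t ∷ suc t ∷ c ∷ []) r (Perm⇒Unique (proj₁ hσ)) (here refl) (there (here refl))))
        A = map (unlift 2 t) (reverse r)
        eq : consIV t (A ++ c ∷ []) ≡ reverse σ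
        eq = trans (consIV-at t A c c<t)
               (trans (cong (_++ c ∷ suc t ∷ t ∷ []) (unlift₂-section av)) (sym (reverse-sandwich [] (t ∷ suc t ∷ c ∷ []) r)))
        τ∈ : A ++ c ∷ [] ∈ R (n ∸ 2) S₃
        τ∈ = R-complete S₃-sorted decreasing₃ (consIV-sound⁻ A c c<t (subst (IsPinPerm n S) (sym eq) (IsPinPerm-reverse hσ)))

      ∈pairBlock : ∀ l c r → IsPinPerm n S (l ++ t ∷ suc t ∷ c ∷ r) → c < t →
                   isPinSet S ≡ true × l ++ t ∷ suc t ∷ c ∷ r ∈ pairBlock R n t T
      ∈pairBlock l c r hσ c<t with initLast l
      ... | [] = map₂ (∈-++⁺ʳ (IIs R) ∘ ∈-++⁺ʳ (IIIs R)) (∈IVs c r hσ c<t)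
      ... | l′ ∷ʳ′ b rewrite ++-assoc l′ (b ∷ []) (t ∷ suc t ∷ c ∷ r) with b <? t
      ...   | yes b<t = map₂ ∈-++⁺ˡ (∈IIs l′ b c r hσ b<t c<t)
      ...   | no b≮t = map₂ (∈-++⁺ʳ (IIs R) ∘ ∈-++⁺ˡ) (∈IIIs l′ b c r hσ t+1<b c<t)
        where
        b∉ = proj₂ (Unique-mid l′ b (t ∷ suc t ∷ c ∷ r) (Perm⇒Unique (proj₁ hσ)))
        t+1<b : suc t < b
        t+1<b = ≤∧≢⇒< (≤∧≢⇒< (≮⇒≥ b≮t) (λ e → b∉ (here (sym e)))) (λ e → b∉ (there (here (sym e))))

      atMax-complete : ∀ {σ} → IsPinPerm n S σ → isPinSet S ≡ true × σ ∈ atMax R n t T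
      atMax-complete {σ} hσ with pins⇒Peak σ (from (proj₂ hσ (suc t)) suc-t∈S)
      ... | l , a , c , r , refl , a≤t , c≤t with a ≟ t | c ≟ t
      ...   | yes refl | yes refl = ⊥-elim (proj₂ (Unique-mid l a (suc a ∷ a ∷ r) (Perm⇒Unique (proj₁ hσ))) (there (here refl)))
      ...   | yes refl | no c≢t = map₂ (∈-++⁺ʳ (map (consI t) (R n S₁)) ∘ ∈-++⁺ˡ) (∈pairBlock l c r hσ (≤∧≢⇒< (s≤s⁻¹ c≤t) c≢t))
      ...   | no a≢t | no c≢t = map₂ ∈-++⁺ˡ (∈Is l a c r hσ a≢t c≢t)
      ...   | no a≢t | yes refl = map₂ reversed
                (∈pairBlock (reverse r) a (reverse l) (subst (IsPinPerm n S) eq (IsPinPerm-reverse hσ)) (≤∧≢⇒< (s≤s⁻¹ a≤t) a≢t))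
        where
        eq : reverse (l ++ a ∷ suc t ∷ t ∷ r) ≡ reverse r ++ t ∷ suc t ∷ a ∷ reverse l
        eq = reverse-sandwich l (a ∷ suc t ∷ t ∷ []) r
        reversed : reverse r ++ t ∷ suc t ∷ a ∷ reverse l ∈ pairBlock R n t T → l ++ a ∷ suc t ∷ t ∷ r ∈ atMax R n t T
        reversed p = ∈-++⁺ʳ (map (consI t) (R n S₁)) (∈-++⁺ʳ (pairBlock R n t T) (subst (_∈ map reverse (pairBlock R n t T))
                       (trans (cong reverse (sym eq)) (reverse-involutive _)) (∈-map⁺ reverse p)))

    module _ (pin : isPinSet S ≡ true) where

      2+|S|≤n : 2 + length S ≤ n
      2+|S|≤n = begin
        2 + length S                ≤⟨ s≤s (subst (_≤ 2 * length S) (+-comm (length S) 1) (+-monoʳ-≤ (length S) (s≤s z≤n))) ⟩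
        suc (2 * length S)          ≤⟨ isPinFrom⇒<maxL 1 s ss pin ⟩
        n                           ∎
        where open ≤-Reasoning

      e : ℕ
      e = n ∸ 2 ∸ length S

      n-1-|S|≡1+e : n ∸ 1 ∸ length S ≡ suc e
      n-1-|S|≡1+e = begin
        n ∸ 1 ∸ length S       ≡⟨ ∸-+-assoc n 1 (length S) ⟩
        n ∸ suc (length S)     ≡⟨ +-∸-assoc 1 2+|S|≤n ⟩
        suc (n ∸ (2 + length S)) ≡⟨ cong suc (∸-+-assoc n 2 (length S)) ⟨
        suc e                  ∎
        where open ≡-Reasoning

      exponent₂ : n ∸ 1 ∸ 1 ∸ length S₂ ≡ e
      exponent₂ = begin
        n ∸ 1 ∸ 1 ∸ length S₂  ≡⟨ cong (λ z → z ∸ length S₂) (∸-+-assoc n 1 1) ⟩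
        n ∸ 2 ∸ length S₂      ≡⟨ cong (n ∸ 2 ∸_) length-S₂ ⟩
        e                      ∎
        where open ≡-Reasoning

      exponent₃ : n ∸ 2 ∸ 1 ∸ length S₃ ≡ e
      exponent₃ = trans (∸-+-assoc (n ∸ 2) 1 (length S₃)) (cong (n ∸ 2 ∸_) length-S₃)

      atMax-count : ∀ (P Q : ℕ → List ℕ → List (List ℕ)) →
        (∀ {m′ S′} → Sorted S′ → length (Q m′ S′) ≡ length (P m′ S′) * 2 ^ (m′ ∸ 1 ∸ length S′)) →
        length (atMax Q n t T) ≡ length (P′-atMax P n t T) * 2 ^ (n ∸ 1 ∸ length S)
      atMax-count P Q count = begin
        length (atMax Q n t T)
          ≡⟨ length-atMax Q n t T ⟩
        length (Q n S₁) + (length (pairBlock Q n t T) + length (pairBlock Q n t T))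
          ≡⟨ cong (λ x → length (Q n S₁) + (x + x)) (length-pairBlock Q n t T) ⟩
        length (Q n S₁) + ((q₂ + (k * q₃ + q₃)) + (q₂ + (k * q₃ + q₃)))
          ≡⟨ cong₂ (λ x y → x + ((y + (k * z + z)) + (y + (k * z + z)))) count₁ count₂ ⟩
        p₁ * (2 * E) + ((p₂ * E + (k * z + z)) + (p₂ * E + (k * z + z)))
          ≡⟨ cong (λ z′ → p₁ * (2 * E) + ((p₂ * E + (k * z′ + z′)) + (p₂ * E + (k * z′ + z′)))) count₃ ⟩
        p₁ * (2 * E) + ((p₂ * E + (k * (p₃ * E) + p₃ * E)) + (p₂ * E + (k * (p₃ * E) + p₃ * E)))
          ≡⟨ count-regroup p₁ p₂ p₃ k E ⟩
        (p₁ + (p₂ + (k * p₃ + p₃))) * (2 * E)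
          ≡⟨ cong₂ _*_ (length-P′-atMax P n t T) (cong (2 ^_) n-1-|S|≡1+e) ⟨
        length (P′-atMax P n t T) * 2 ^ (n ∸ 1 ∸ length S) ∎
        where
        open ≡-Reasoning
        k = length (range t (n ∸ 2))
        E = 2 ^ e
        p₁ = length (P n S₁)
        p₂ = length (P (n ∸ 1) S₂)
        p₃ = length (P (n ∸ 2) S₃)
        q₂ = length (Q (n ∸ 1) S₂)
        q₃ = length (Q (n ∸ 2) S₃)
        z = q₃
        count₁ : length (Q n S₁) ≡ p₁ * (2 * E)
        count₁ = trans (count S₁-sorted) (cong (λ x → p₁ * 2 ^ x) (trans (cong (n ∸ 1 ∸_) length-S₁) n-1-|S|≡1+e))
        count₂ : q₂ ≡ p₂ * E
        count₂ = trans (count S₂-sorted) (cong (λ x → p₂ * 2 ^ x) exponent₂)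
        count₃ : q₃ ≡ p₃ * E
        count₃ = trans (count S₃-sorted) (cong (λ x → p₃ * 2 ^ x) exponent₃)

bothEnds-sound : ∀ {m S R} → 1 ≤ m → (∀ {τ} → τ ∈ R → IsPinPerm (m ∸ 1) S τ) →
                 ∀ {σ} → σ ∈ bothEnds m R → IsPinPerm m S σ
bothEnds-sound {suc k} {S} {R} _ R-sound p with ∈-++⁻ (map (_++ suc k ∷ []) R) p
... | inj₁ q with ∈-map⁻ (_++ suc k ∷ []) q
...   | τ , τ∈ , refl = let (pτ , hτ) = R-sound τ∈ in
  Perm-resp-↭ (↭.∷↭∷ʳ (suc k) τ) (to (Perm-∷-max k) pτ) ,
  (λ x → subst (λ z → x ∈ z ⇔ x ∈ S) (sym (pins-∷ʳ-max (suc k) τ (below pτ))) (hτ x))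
  where
  below : ∀ {τ} → Perm k τ → All (_< suc k) τ
  below pτ = All.tabulate (λ y∈ → s≤s (proj₂ (Perm-∈⁻ pτ y∈)))
bothEnds-sound {suc k} {S} {R} _ R-sound p | inj₂ q with ∈-map⁻ (suc k ∷_) q
...   | τ , τ∈ , refl = let (pτ , hτ) = R-sound τ∈ in
  to (Perm-∷-max k) pτ ,
  (λ x → subst (λ z → x ∈ z ⇔ x ∈ S) (sym (pins-∷-max (suc k) τ (All.tabulate (λ y∈ → s≤s (proj₂ (Perm-∈⁻ pτ y∈)))))) (hτ x))

vShaped-sound : ∀ m {σ} → σ ∈ vShaped m → IsPinPerm m [] σ
vShaped-sound zero (here refl) = ↭.↭-refl , λ x → mk⇔ (λ ()) (λ ())
vShaped-sound (suc zero) (here refl) = ↭.↭-refl , λ x → mk⇔ (λ ()) (λ ())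
vShaped-sound (suc (suc k)) = bothEnds-sound (s≤s z≤n) (vShaped-sound (suc k))

PinPermsf-sound : ∀ f m S {σ} → σ ∈ PinPermsf f m S → IsPinPerm m S σ
PinPermsf-sound zero m S ()
PinPermsf-sound (suc f) m [] p = vShaped-sound m p
PinPermsf-sound (suc f) m (s ∷ ss) {σ} p with isPinSet (s ∷ ss) in pin
... | true with m <ᵇ maxL (s ∷ ss) in m≮n
...   | false with maxL (s ∷ ss) <ᵇ m in n<m
...     | true = bothEnds-sound (≤-trans z<s (<ᵇ-true⁻ n<m)) (PinPermsf-sound f (m ∸ 1) (s ∷ ss)) p
...     | false rewrite ≤-antisym (<ᵇ-false⁻ {maxL (s ∷ ss)} n<m) (<ᵇ-false⁻ {m} m≮n) =
  AtMax.atMax-sound s ss (isPinSet⇒2< (s ∷ ss) pin) (PinPermsf f) (PinPermsf-sound f _ _) p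

bothEnds-unique : ∀ {m R} → 2 ≤ m → Unique R → (∀ {τ} → τ ∈ R → Perm (m ∸ 1) τ) → Unique (bothEnds m R)
bothEnds-unique {suc k} {R} (s≤s 1≤k) u R-perm =
  Unique.++⁺ (Unique.map⁺ (λ {a} {b} e → ∷ʳ-injectiveˡ a b e) u) (Unique.map⁺ (proj₂ ∘ ∷-injective) u) disjoint
  where
  disjoint : Disjoint (map (_++ suc k ∷ []) R) (map (suc k ∷_) R)
  disjoint (p , p′) with ∈-map⁻ (_++ suc k ∷ []) p | ∈-map⁻ (suc k ∷_) p′
  ... | τ , τ∈ , refl | _ , _ , e with τ | R-perm τ∈
  ...   | [] | pτ = case (Perm-∈⁺ pτ (≤-refl , 1≤k))
    where
    case : 1 ∉ []
    case ()
  ...   | a ∷ _ | pτ = <-irrefl (proj₁ (∷-injective e)) (s≤s (proj₂ (Perm-∈⁻ pτ (here refl))))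

vShaped-unique : ∀ m → Unique (vShaped m)
vShaped-unique zero = [] ∷ []
vShaped-unique (suc zero) = [] ∷ []
vShaped-unique (suc (suc k)) = bothEnds-unique (s≤s (s≤s z≤n)) (vShaped-unique (suc k)) (proj₁ ∘ vShaped-sound (suc k))

PinPermsf-unique : ∀ f m S → Unique (PinPermsf f m S)
PinPermsf-unique zero m S = []
PinPermsf-unique (suc f) m [] = vShaped-unique m
PinPermsf-unique (suc f) m (s ∷ ss) with isPinSet (s ∷ ss) in pin
... | false = []
... | true with m <ᵇ maxL (s ∷ ss) in m≮n
...   | true = []
...   | false with maxL (s ∷ ss) <ᵇ m in n<m
...     | true = bothEnds-unique (<⇒≤ (≤-<-trans (<⇒≤ (isPinSet⇒2< (s ∷ ss) pin (maxL-∈ s ss))) (<ᵇ-true⁻ n<m)))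
                   (PinPermsf-unique f (m ∸ 1) (s ∷ ss)) (proj₁ ∘ PinPermsf-sound f (m ∸ 1) (s ∷ ss))
...     | false = AtMax.atMax-unique s ss (isPinSet⇒2< (s ∷ ss) pin) (PinPermsf f) (PinPermsf-sound f _ _) (PinPermsf-unique f)

-- Completeness obtains isPinSet S from the recursive calls instead of proving that every pinnacle
-- set satisfies s_i > 2i.
PinPermsf⇒isPinSet : ∀ f m S {σ} → σ ∈ PinPermsf f m S → isPinSet S ≡ true
PinPermsf⇒isPinSet (suc f) m [] _ = refl
PinPermsf⇒isPinSet (suc f) m (s ∷ ss) p with isPinSet (s ∷ ss)
... | true = refl

bothEnds-complete : ∀ {m R σ τ} → τ ∈ R → σ ≡ τ ++ m ∷ [] ⊎ σ ≡ m ∷ τ → σ ∈ bothEnds m R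
bothEnds-complete {m} {R} τ∈ (inj₁ refl) = ∈-++⁺ˡ (∈-map⁺ (_++ m ∷ []) τ∈)
bothEnds-complete {m} {R} τ∈ (inj₂ refl) = ∈-++⁺ʳ (map (_++ m ∷ []) R) (∈-map⁺ (m ∷_) τ∈)

vShaped-complete : ∀ m {σ} → IsPinPerm m [] σ → σ ∈ vShaped m
vShaped-complete zero (pσ , _) rewrite ↭.↭-empty-inv pσ = here refl
vShaped-complete (suc zero) (pσ , _) rewrite ↭.↭-singleton-inv pσ = here refl
vShaped-complete (suc (suc k)) hσ =
  let (τ , hτ , σ≡) = maxAtEnd (s≤s z≤n) hσ (λ ()) in bothEnds-complete (vShaped-complete (suc k) hτ) σ≡

PinPermsf-complete : ∀ f m S {σ} → Sorted S → m + sum S < f → IsPinPerm m S σ → σ ∈ PinPermsf f m S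
PinPermsf-complete (suc f) m [] _ _ hσ = vShaped-complete m hσ
PinPermsf-complete (suc f) m (s ∷ ss) {σ} S-sorted m+ΣS<1+f hσ with <-cmp m (maxL (s ∷ ss))
... | tri< m<n _ _ = ⊥-elim (<⇒≱ m<n (proj₂ (Perm-∈⁻ (proj₁ hσ) (pins⊆ σ (from (proj₂ hσ _) (maxL-∈ s ss))))))
... | tri> _ _ n<m with maxAtEnd (≤-trans z<s n<m) hσ (λ m∈S → <⇒≱ n<m (≤-maxL (s ∷ ss) m∈S))
...   | τ , hτ , σ≡ with PinPermsf-complete f (m ∸ 1) (s ∷ ss) S-sorted
                         (<-≤-trans (+-monoˡ-< (sum (s ∷ ss)) (≤pred⇒< (≤-trans z<s n<m) ≤-refl)) (s≤s⁻¹ m+ΣS<1+f)) hτ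
...     | τ∈ rewrite PinPermsf⇒isPinSet f (m ∸ 1) (s ∷ ss) τ∈ | <ᵇ-false (<⇒≤ n<m) | <ᵇ-true n<m =
  bothEnds-complete τ∈ σ≡
PinPermsf-complete (suc f) m (s ∷ ss) {σ} S-sorted m+ΣS<1+f hσ | tri≈ _ refl _
  with AtMax.atMax-complete s ss (IsPinPerm⇒2< hσ) S-sorted (PinPermsf f)
         (λ S′-sorted lt → PinPermsf-complete f _ _ S′-sorted (<-≤-trans lt (s≤s⁻¹ m+ΣS<1+f)))
         (PinPermsf⇒isPinSet f _ _) hσ
... | pin , σ∈ rewrite pin | <ᵇ-false {maxL (s ∷ ss)} ≤-refl = σ∈

P′-atMax⊆atMax : ∀ {P Q : ℕ → List ℕ → List (List ℕ)} n t T → (∀ m S → P m S ⊆ Q m S) →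
                 P′-atMax P n t T ⊆ atMax Q n t T
P′-atMax⊆atMax {P} {Q} n t T P⊆Q =
  ⊆.++⁺ (⊆.map⁺ (consI t) (P⊆Q _ _))
    (⊆.++⁺ (⊆.++⁺ʳ (IIIs ++ IVs) (⊆.map⁺ (consII t) (P⊆Q _ _)))
      (subst (_ ⊆_) (sym reverse-block)
        (⊆.++⁺ˡ (map reverse IIs)
          (⊆.++⁺ (concatMap-⊆ _ _ (range t (n ∸ 2)) λ q → ⊆.map⁺ (consIII t q) (P⊆Q _ _))
                 (⊆.map⁺ (consIV t) (P⊆Q _ _))))))
  where
  Q₂ = Q (n ∸ 1) (T ++ range t (n ∸ 1))
  Q₃ = Q (n ∸ 2) (T ++ range t (n ∸ 2))
  IIs = map (consII t) Q₂
  IIIs = concatMap (λ q → map (reverse ∘ consIII t q) Q₃) (range t (n ∸ 2))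
  IVs = map (reverse ∘ consIV t) Q₃
  reverse-block : map reverse (IIs ++ IIIs ++ IVs) ≡
                  map reverse IIs ++ concatMap (λ q → map (consIII t q) Q₃) (range t (n ∸ 2)) ++ map (consIV t) Q₃
  reverse-block = begin
    map reverse (IIs ++ IIIs ++ IVs)                            ≡⟨ map-++ reverse IIs (IIIs ++ IVs) ⟩
    map reverse IIs ++ map reverse (IIIs ++ IVs)                ≡⟨ cong (map reverse IIs ++_) (map-++ reverse IIIs IVs) ⟩
    map reverse IIs ++ map reverse IIIs ++ map reverse IVs
      ≡⟨ cong₂ (λ x y → map reverse IIs ++ x ++ y)
           (trans (map-concatMap reverse _ (range t (n ∸ 2))) (concatMap-cong (λ q → map-reverse-reverse (consIII t q) Q₃) (range t (n ∸ 2))))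
           (map-reverse-reverse (consIV t) Q₃) ⟩
    map reverse IIs ++ concatMap (λ q → map (consIII t q) Q₃) (range t (n ∸ 2)) ++ map (consIV t) Q₃ ∎
    where open ≡-Reasoning

P'f⊆PinPermsf : ∀ f m S → P'f f m S ⊆ PinPermsf f m S
P'f⊆PinPermsf zero m S = []
P'f⊆PinPermsf (suc f) m [] =
  from∈ (vShaped-complete m (↭.↭-refl , λ x → mk⇔ (⊥-elim ∘ Sorted⇒∉pins (range-sorted 1 m)) (λ ())))
P'f⊆PinPermsf (suc f) m (s ∷ ss) rewrite P′f-unfold f m s ss with isPinSet (s ∷ ss)
... | false = []
... | true with m <ᵇ maxL (s ∷ ss)
...   | true = []
...   | false with maxL (s ∷ ss) <ᵇ m
...     | true = ⊆.++⁺ʳ _ (⊆.map⁺ (_++ m ∷ []) (P'f⊆PinPermsf f (m ∸ 1) (s ∷ ss)))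
...     | false = P′-atMax⊆atMax _ _ _ (P'f⊆PinPermsf f)

length-bothEnds : ∀ m R → length (bothEnds m R) ≡ length R + length R
length-bothEnds m R = trans (length-++ (map (_++ m ∷ []) R)) (cong₂ _+_ (length-map _ R) (length-map _ R))

vShaped-length : ∀ m → length (vShaped m) ≡ 2 ^ (m ∸ 1)
vShaped-length zero = refl
vShaped-length (suc zero) = refl
vShaped-length (suc (suc k)) =
  trans (length-bothEnds (suc (suc k)) (vShaped (suc k)))
        (trans (cong₂ _+_ (vShaped-length (suc k)) (vShaped-length (suc k))) (cong (2 ^ k +_) (sym (+-identityʳ (2 ^ k)))))

PinPermsf-count : ∀ f m S → Sorted S → length (PinPermsf f m S) ≡ length (P'f f m S) * 2 ^ (m ∸ 1 ∸ length S)
PinPermsf-count zero m S _ = refl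
PinPermsf-count (suc f) m [] _ = trans (vShaped-length m) (sym (+-identityʳ _))
PinPermsf-count (suc f) m (s ∷ ss) S-sorted rewrite P′f-unfold f m s ss with isPinSet (s ∷ ss) in pin
... | false = refl
... | true with m <ᵇ maxL (s ∷ ss) in m≮n
...   | true = refl
...   | false with maxL (s ∷ ss) <ᵇ m in n<m
...     | true = begin
  length (bothEnds m Q)              ≡⟨ length-bothEnds m Q ⟩
  length Q + length Q                ≡⟨ cong (λ x → x + x) (PinPermsf-count f (m ∸ 1) S S-sorted) ⟩
  p * 2 ^ x + p * 2 ^ x              ≡⟨ *-distribˡ-+ p (2 ^ x) (2 ^ x) ⟨
  p * (2 ^ x + 2 ^ x)                ≡⟨ cong (λ y → p * (2 ^ x + y)) (+-identityʳ (2 ^ x)) ⟨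
  p * 2 ^ suc x                      ≡⟨ cong₂ (λ y z → y * 2 ^ z) (length-map (_++ m ∷ []) (P'f f (m ∸ 1) S)) exponent ⟨
  length (map (_++ m ∷ []) (P'f f (m ∸ 1) S)) * 2 ^ (m ∸ 1 ∸ length S) ∎
  where
  open ≡-Reasoning
  S = s ∷ ss
  Q = PinPermsf f (m ∸ 1) S
  p = length (P'f f (m ∸ 1) S)
  x = m ∸ 1 ∸ 1 ∸ length S
  |S|<m-1 : length S < m ∸ 1
  |S|<m-1 = suc[m]≤n⇒m≤pred[n] (≤-trans (AtMax.2+|S|≤n s ss (isPinSet⇒2< S pin) S-sorted pin) (<⇒≤ (<ᵇ-true⁻ {maxL S} {m} n<m)))
  exponent : m ∸ 1 ∸ length S ≡ suc x
  exponent = trans (+-∸-assoc 1 |S|<m-1) (cong suc (sym (∸-+-assoc (m ∸ 1) 1 (length S))))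
...     | false rewrite ≤-antisym (<ᵇ-false⁻ {maxL (s ∷ ss)} n<m) (<ᵇ-false⁻ {m} m≮n) =
  AtMax.atMax-count s ss (isPinSet⇒2< (s ∷ ss) pin) S-sorted pin (P'f f) (PinPermsf f) (PinPermsf-count f _ _)

mainTheorem6 : (m : ℕ) (S : List ℕ) → 1 ≤ m → Linked _<_ S → All (λ s → 1 ≤ s) S →
    ((σ : List ℕ) → σ ∈ P' m S → (σ ↭ range 1 m) × ((x : ℕ) → (x ∈ pins σ) ⇔ (x ∈ S)))
    × Unique (P' m S)
    × ∃ (λ (L : List (List ℕ)) → Unique L
    × ((σ : List ℕ) → (σ ∈ L) ⇔ ((σ ↭ range 1 m) × ((x : ℕ) → (x ∈ pins σ) ⇔ (x ∈ S))))
    × (length L ≡ length (P' m S) * 2 ^ (m ∸ 1 ∸ length S)))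
mainTheorem6 m S _ S-linked _ =
    (λ σ σ∈P′ → PinPermsf-sound F m S (lookup (P'f⊆PinPermsf F m S) σ∈P′))
  , Unique-⊆ (P'f⊆PinPermsf F m S) (PinPermsf-unique F m S)
  , PinPermsf F m S
  , PinPermsf-unique F m S
  , (λ σ → mk⇔ (PinPermsf-sound F m S) (PinPermsf-complete F m S S-sorted ≤-refl))
  , PinPermsf-count F m S S-sorted
  where
  F = suc (m + sum S)
  S-sorted : Sorted S
  S-sorted = Linked.Linked⇒AllPairs <-trans S-linked
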